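{- Let $m\ge 3$, $n\ge 3$, let $W_m$ be the wheel with $m$ rim vertices and $C_n$ the cycle on $n$ vertices, and let $\Delta$ be the maximum degree of $W_m\times C_n$. Then $\chi''_{\Sigma}(W_m\times C_n)=\Delta+2$.
   Context: All graphs are finite and simple. A proper total $k$-coloring of a graph $G$ assigns to every vertex and every edge a color from $\{1,\dots,k\}$ such that adjacent vertices receive different colors, edges sharing an endpoint receive different colors, and no edge receives the same color as either of its endpoints. For such a coloring $c$ and a vertex $v$, let $f(v)=c(v)+\sum_{e\ni v} c(e)$. The coloring distinguishes adjacent vertices by sums if $f(u)\neq f(v)$ for every edge $uv$. $\chi''_{\Sigma}(G)$ denotes the smallest $k$ such that $G$ has a proper total $k$-coloring distinguishing adjacent vertices by sums. The product $G_1\times G_2$ is the Cartesian product: vertex set $V(G_1)\times V(G_2)$, with $(u_1,u_2)$ adjacent to $(v_1,v_2)$ iff either $u_1=v_1$ and $u_2v_2\in E(G_2)$, or $u_1v_1\in E(G_1)$ and $u_2=v_2$. The wheel $W_m$ consists of a cycle on $m$ vertices together with a central vertex adjacent to all of them ($W_3=K_4$). -}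

module Defs where

open import Data.Nat using (ℕ; zero; suc; _+_; _*_; _≤_; _<_; _⊔_; _%_)
open import Data.Nat.Properties using (_≟_)
open import Data.Fin using (Fin; toℕ; remQuot) renaming (zero to fzero; suc to fsuc)
open import Data.Fin.Properties using () renaming (_≟_ to _≟ᶠ_)
open import Data.Bool using (Bool; true; false; if_then_else_; _∧_; _∨_; not)
open import Data.Nat.ListAction using (sum)
open import Data.List using (List; map; foldr; allFin; length; filter)
open import Data.Product using (_×_; _,_; proj₁; proj₂; Σ; ∃)
open import Relation.Nullary using (¬_)
open import Relation.Nullary.Decidable using (⌊_⌋)
open import Relation.Binary.PropositionalEquality using (_≡_; _≢_)

-- A finite graph on the vertex set Fin V, given by a Boolean adjacency
-- matrix. (All graphs built below are symmetric and irreflexive by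
-- construction, i.e. simple.)
record Graph : Set where
  constructor mkGraph
  field
    V      : ℕ
    adj    : Fin V → Fin V → Bool
open Graph public

Adj : (G : Graph) → Fin (V G) → Fin (V G) → Set
Adj G u v = adj G u v ≡ true

degree : (G : Graph) → Fin (V G) → ℕ
degree G v = length (filter (λ w → Data.Bool._≟_ (adj G v w) true) (allFin (V G)))
  where import Data.Bool

maxDegree : (G : Graph) → ℕ
maxDegree G = foldr _⊔_ 0 (map (degree G) (allFin (V G)))

-- A total coloring: a color for each vertex and a color for each (ordered) pair,
-- the latter meaningful only on edges (where it is required to be symmetric).
record TotalColoring (G : Graph) : Set where
  field
    vcol : Fin (V G) → ℕ
    ecol : Fin (V G) → Fin (V G) → ℕ
open TotalColoring public

weight : (G : Graph) → TotalColoring G → Fin (V G) → ℕ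
weight G c v = vcol c v + sum (map (λ w → if adj G v w then ecol c v w else 0) (allFin (V G)))

IsProperTotal : (G : Graph) → ℕ → TotalColoring G → Set
IsProperTotal G k c =
  (∀ v → 1 ≤ vcol c v × vcol c v ≤ k) ×
  (∀ u v → Adj G u v → 1 ≤ ecol c u v × ecol c u v ≤ k) ×
  (∀ u v → Adj G u v → ecol c u v ≡ ecol c v u) ×
  (∀ u v → Adj G u v → vcol c u ≢ vcol c v) ×
  (∀ u v → Adj G u v → ecol c u v ≢ vcol c u × ecol c u v ≢ vcol c v) ×
  (∀ u v w → Adj G u v → Adj G u w → v ≢ w → ecol c u v ≢ ecol c u w)

DistinguishesBySums : (G : Graph) → TotalColoring G → Set
DistinguishesBySums G c = ∀ u v → Adj G u v → weight G c u ≢ weight G c v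

HasNSDTC : Graph → ℕ → Set
HasNSDTC G k = Σ (TotalColoring G) λ c → IsProperTotal G k c × DistinguishesBySums G c

χΣ≡ : Graph → ℕ → Set
χΣ≡ G k = HasNSDTC G k × (∀ j → j < k → ¬ HasNSDTC G j)

cycleAdj : (n : ℕ) → Fin n → Fin n → Bool
cycleAdj n i j = not ⌊ i ≟ᶠ j ⌋ ∧
  (⌊ (suc (toℕ i) % suc n') ≟ toℕ j ⌋ ∨ ⌊ (suc (toℕ j) % suc n') ≟ toℕ i ⌋)
  where n' = Data.Nat.pred n
        import Data.Nat

cycle : ℕ → Graph
cycle n = mkGraph n (cycleAdj n)

-- wheel W_m on Fin (suc m): vertex 0 is the center, vertices suc i (i : Fin m)
-- form the rim cycle C_m.
wheelAdj : (m : ℕ) → Fin (suc m) → Fin (suc m) → Bool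
wheelAdj m fzero    fzero    = false
wheelAdj m fzero    (fsuc j) = true
wheelAdj m (fsuc i) fzero    = true
wheelAdj m (fsuc i) (fsuc j) = cycleAdj m i j

wheel : ℕ → Graph
wheel m = mkGraph (suc m) (wheelAdj m)

productAdj : (G₁ G₂ : Graph) → Fin (V G₁ * V G₂) → Fin (V G₁ * V G₂) → Bool
productAdj G₁ G₂ x y with remQuot (V G₂) x | remQuot (V G₂) y
... | (x₁ , x₂) | (y₁ , y₂) =
  (⌊ x₁ ≟ᶠ y₁ ⌋ ∧ adj G₂ x₂ y₂) ∨ (adj G₁ x₁ y₁ ∧ ⌊ x₂ ≟ᶠ y₂ ⌋)

_□_ : Graph → Graph → Graph
G₁ □ G₂ = mkGraph (V G₁ * V G₂) (productAdj G₁ G₂)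

-- The maximum degree of W_m □ C_n is m + 2, attained on the hub column. At a hub vertex, the vertex
-- and its m + 2 edges need m + 3 distinct colours; when exactly m + 3 colours are available these are
-- 1, …, m + 3, so every hub vertex has the same weight and two adjacent hubs collide. Hence m + 4
-- colours are needed. For the upper bound, row j (the copy of W_m over position j of C_n) is coloured
-- according to the classes of j - 1 and j only, where positions alternate between even and odd and
-- the last position is a class of its own. Only seven class triples occur around the cycle, so
-- finitely many conditions per row remain. For m = 3, 4, 5 explicit tables satisfy them by
-- evaluation. For m ≥ 6 the spokes at a hub receive the colours 5, …, m + 4 (one of them lowered to
-- 4 in the last row), the rim vertices and rim edges receive the same colours shifted along the rim
-- by amounts depending on the class, and the small colours 1, …, 4 go to the vertical edges and
-- hubs: a hub then outweighs its rim neighbours, and the shifts separate all other neighbours.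

module Submission where

open import Defs
open import Data.Nat using (ℕ; _≤_; _+_)

open import Data.Nat as ℕ using (zero; suc; _<_; _%_; _⊔_; z≤n; s≤s)
import Data.Nat.Properties as ℕ
open import Data.Nat.DivMod using (m%n<n; n%n≡0; m<n⇒m%n≡m)
open import Data.Nat.Tactic.RingSolver using (solve-∀)
open import Algebra.Properties.CommutativeSemigroup ℕ.+-commutativeSemigroup using () renaming (xy∙z≈xz∙y to swap)
open import Data.Fin as Fin using (Fin; toℕ; fromℕ<; fromℕ; inject₁; combine; remQuot)
  renaming (zero to fzero; suc to fsuc)
import Data.Fin.Properties as Fin
open import Data.Bool using (true; false; if_then_else_; _∧_; _∨_)
open import Data.Bool.Properties using (T-≡; ∨-zeroʳ) renaming (_≟_ to _≟ᵇ_)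
open import Data.Product using (_×_; _,_; proj₁; proj₂; ∃; uncurry)
open import Data.Sum using (_⊎_; inj₁; inj₂; [_,_]′)
open import Data.Empty using (⊥; ⊥-elim)
open import Data.Nat.ListAction using (sum)
open import Data.List as List using (List; []; _∷_; map; length; allFin; filter; _++_)
import Data.List.Properties as List
open import Data.List.Relation.Unary.All as All using (All; []; _∷_)
open import Data.List.Relation.Unary.Any as Any using (Any; here; there)
import Data.List.Relation.Unary.All.Properties as All
open import Data.List.Relation.Unary.AllPairs using ([]; _∷_; allPairs?)
open import Data.Vec as Vec using (Vec; []; _∷_)
open import Data.List.Relation.Unary.Unique.Propositional using (Unique)
open import Data.List.Relation.Unary.Unique.DecPropositional ℕ._≟_ using (unique?)
import Data.List.Relation.Unary.Unique.Propositional.Properties as Unique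
open import Data.List.Membership.Propositional using (_∈_)
open import Data.List.Membership.Propositional.Properties
  using (∈-∃++; ∈-filter⁺; ∈-filter⁻; ∈-allFin; ∈-map⁺; ∈-map⁻)
open import Data.List.Membership.Propositional.Properties.WithK using (unique∧set⇒bag)
open import Data.List.Relation.Binary.BagAndSetEquality using (∼bag⇒↭)
open import Data.List.Relation.Binary.Permutation.Propositional using (_↭_)
import Data.List.Relation.Binary.Permutation.Propositional as ↭
import Data.List.Relation.Binary.Permutation.Propositional.Properties as ↭
import Data.List.Relation.Binary.Permutation.Setoid.Properties as ↭ₛ
open import Data.Nat.ListAction.Properties using (sum-↭)
open import Function using (id; _∘_; Equivalence; mk⇔)
open import Relation.Nullary using (¬_; Dec; yes; no; does)
open import Relation.Nullary.Decidable
  using (⌊_⌋; isYes≗does; dec-true; dec-false; toWitness; from-yes; map′; _×-dec_; ¬?)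
open import Relation.Binary.PropositionalEquality
  using (_≡_; _≢_; refl; sym; trans; cong; cong₂; subst; setoid; module ≡-Reasoning)

⌊⌋-true : ∀ {A : Set} (a? : Dec A) → A → ⌊ a? ⌋ ≡ true
⌊⌋-true a? a = trans (isYes≗does a?) (dec-true a? a)

⌊⌋-false : ∀ {A : Set} (a? : Dec A) → ¬ A → ⌊ a? ⌋ ≡ false
⌊⌋-false a? ¬a = trans (isYes≗does a?) (dec-false a? ¬a)

if-yes : ∀ {A B : Set} (a? : Dec A) {x y : B} → A → (if ⌊ a? ⌋ then x else y) ≡ x
if-yes a? a = cong (if_then _ else _) (⌊⌋-true a? a)

if-no : ∀ {A B : Set} (a? : Dec A) {x y : B} → ¬ A → (if ⌊ a? ⌋ then x else y) ≡ y
if-no a? ¬a = cong (if_then _ else _) (⌊⌋-false a? ¬a)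

⌊⌋-witness : ∀ {A : Set} (a? : Dec A) → ⌊ a? ⌋ ≡ true → A
⌊⌋-witness a? h = toWitness (Equivalence.from T-≡ h)

suc≢0 : ∀ {x} → suc x ≢ 0
suc≢0 ()

-- Cyclic successor and predecessor on Fin n

next : ∀ {n} → Fin n → Fin n
next {suc n} j = fromℕ< (m%n<n (suc (toℕ j)) (suc n))

prev : ∀ {n} → Fin n → Fin n
prev {suc n} fzero    = fromℕ n
prev {suc n} (fsuc k) = inject₁ k

toℕ-next : ∀ {n} (j : Fin (suc n)) → toℕ (next j) ≡ suc (toℕ j) % suc n
toℕ-next {n} j = Fin.toℕ-fromℕ< (m%n<n (suc (toℕ j)) (suc n))

data NextView {n} (j : Fin (suc n)) : Set where
  inner : suc (toℕ j) < suc n → toℕ (next j) ≡ suc (toℕ j) → NextView j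
  wrap  : toℕ j ≡ n → toℕ (next j) ≡ 0 → NextView j

nextView : ∀ {n} (j : Fin (suc n)) → NextView j
nextView {n} j with ℕ.m≤n⇒m<n∨m≡n (Fin.toℕ<n j)
... | inj₁ lt = inner lt (trans (toℕ-next j) (m<n⇒m%n≡m lt))
... | inj₂ eq = wrap (ℕ.suc-injective eq) (trans (toℕ-next j) (trans (cong (_% suc n) eq) (n%n≡0 (suc n))))

next-prev : ∀ {n} (j : Fin n) → next (prev j) ≡ j
next-prev {suc n} fzero with nextView (prev {suc n} fzero)
... | inner lt _ = ⊥-elim (ℕ.<-irrefl (cong suc (Fin.toℕ-fromℕ n)) lt)
... | wrap _ e   = Fin.toℕ-injective e
next-prev {suc n} (fsuc k) with nextView (prev {suc n} (fsuc k))
... | inner _ e = Fin.toℕ-injective (trans e (cong suc (Fin.toℕ-inject₁ k)))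
... | wrap e _  = ⊥-elim (ℕ.<-irrefl (trans (sym (Fin.toℕ-inject₁ k)) e) (Fin.toℕ<n k))

next-injective : ∀ {n} {i j : Fin n} → next i ≡ next j → i ≡ j
next-injective {suc n} {i} {j} e with nextView i | nextView j
... | inner _ a | inner _ b = Fin.toℕ-injective (ℕ.suc-injective (trans (sym a) (trans (cong toℕ e) b)))
... | inner _ a | wrap _ b  = ⊥-elim (suc≢0 (trans (sym a) (trans (cong toℕ e) b)))
... | wrap _ a  | inner _ b = ⊥-elim (suc≢0 (trans (sym b) (trans (cong toℕ (sym e)) a)))
... | wrap a _  | wrap b _  = Fin.toℕ-injective (trans a (sym b))

prev-next : ∀ {n} (j : Fin n) → prev (next j) ≡ j
prev-next j = next-injective (next-prev (next j))

next≢id : ∀ {n} (j : Fin (suc (suc n))) → next j ≢ j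
next≢id j e with nextView j
... | inner _ a = ℕ.<-irrefl (sym (trans (sym a) (cong toℕ e))) (ℕ.n<1+n (toℕ j))
... | wrap a b  = suc≢0 (trans (sym a) (trans (sym (cong toℕ e)) b))

prev≢id : ∀ {n} (j : Fin (suc (suc n))) → prev j ≢ j
prev≢id j e = next≢id j (trans (sym (cong next e)) (next-prev j))

next²≢id : ∀ {n} (j : Fin (3 + n)) → next (next j) ≢ j
next²≢id j e with nextView j | nextView (next j)
... | inner _ a | inner _ b = ℕ.<-irrefl (trans (sym (cong toℕ e)) (trans b (cong suc a)))
                                (ℕ.<-trans (ℕ.n<1+n (toℕ j)) (ℕ.n<1+n (suc (toℕ j))))
... | inner _ a | wrap b c  = suc≢0 (trans (sym (ℕ.suc-injective (trans (sym a) b))) (trans (sym (cong toℕ e)) c))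
... | wrap a b  | inner _ c = suc≢0 (ℕ.suc-injective (trans (sym a) (trans (trans (sym (cong toℕ e)) c) (cong suc b))))
... | wrap a b  | wrap c d  = suc≢0 (trans (sym c) b)

next≢prev : ∀ {n} (j : Fin (3 + n)) → next j ≢ prev j
next≢prev j e = next²≢id j (trans (cong next e) (next-prev j))

cycleAdj⇒next⊎prev : ∀ {n} (i j : Fin (suc n)) → cycleAdj (suc n) i j ≡ true → j ≡ next i ⊎ j ≡ prev i
cycleAdj⇒next⊎prev {n} i j h
  with i Fin.≟ j | suc (toℕ i) % suc n ℕ.≟ toℕ j | suc (toℕ j) % suc n ℕ.≟ toℕ i
cycleAdj⇒next⊎prev i j () | yes _ | _ | _
... | no _ | yes e | _    = inj₁ (Fin.toℕ-injective (trans (sym e) (sym (toℕ-next i))))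
... | no _ | no _ | yes e =
  inj₂ (trans (sym (prev-next j)) (cong prev (Fin.toℕ-injective (trans (toℕ-next j) e))))
cycleAdj⇒next⊎prev i j () | no _ | no _ | no _

cycleAdj-intro : ∀ {n} (i j : Fin (suc n)) → i ≢ j →
  toℕ j ≡ suc (toℕ i) % suc n ⊎ toℕ i ≡ suc (toℕ j) % suc n → cycleAdj (suc n) i j ≡ true
cycleAdj-intro {n} i j i≢j h
  with i Fin.≟ j | suc (toℕ i) % suc n ℕ.≟ toℕ j | suc (toℕ j) % suc n ℕ.≟ toℕ i
... | yes e | _ | _       = ⊥-elim (i≢j e)
... | no _ | yes _ | _    = refl
... | no _ | no _ | yes _ = refl
... | no _ | no a | no b with h
...   | inj₁ e = ⊥-elim (a (sym e))
...   | inj₂ e = ⊥-elim (b (sym e))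

cycleAdj-next : ∀ {n} (i : Fin (2 + n)) → cycleAdj (2 + n) i (next i) ≡ true
cycleAdj-next i = cycleAdj-intro i (next i) (next≢id i ∘ sym) (inj₁ (toℕ-next i))

cycleAdj-prev : ∀ {n} (i : Fin (2 + n)) → cycleAdj (2 + n) i (prev i) ≡ true
cycleAdj-prev i = cycleAdj-intro i (prev i) (prev≢id i ∘ sym)
  (inj₂ (trans (cong toℕ (sym (next-prev i))) (toℕ-next (prev i))))

cycleAdj-next⁻¹ : ∀ {n} (i : Fin (2 + n)) → cycleAdj (2 + n) (next i) i ≡ true
cycleAdj-next⁻¹ i = subst (λ z → cycleAdj _ (next i) z ≡ true) (prev-next i) (cycleAdj-prev (next i))

cycleAdj-prev⁻¹ : ∀ {n} (i : Fin (2 + n)) → cycleAdj (2 + n) (prev i) i ≡ true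
cycleAdj-prev⁻¹ i = subst (λ z → cycleAdj _ (prev i) z ≡ true) (next-prev i) (cycleAdj-next (prev i))

shift : ∀ {n} → ℕ → Fin n → Fin n
shift zero    x = x
shift (suc d) x = next (shift d x)

shift-next : ∀ {n} d (x : Fin n) → shift d (next x) ≡ next (shift d x)
shift-next zero    x = refl
shift-next (suc d) x = cong next (shift-next d x)

shift-+ : ∀ {n} a b (x : Fin n) → shift a (shift b x) ≡ shift (a + b) x
shift-+ zero    b x = refl
shift-+ (suc a) b x = cong next (shift-+ a b x)

toℕ-shift : ∀ {n} d (x : Fin (suc n)) → d < suc n →
  toℕ (shift d x) ≡ toℕ x + d ⊎ toℕ (shift d x) + suc n ≡ toℕ x + d
toℕ-shift zero x _ = inj₁ (sym (ℕ.+-identityʳ (toℕ x)))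
toℕ-shift {n} (suc d) x d<n
  with toℕ-shift d x (ℕ.<-trans (ℕ.n<1+n d) d<n) | nextView (shift d x)
... | inj₁ a | inner _ e = inj₁ (trans e (trans (cong suc a) (sym (ℕ.+-suc (toℕ x) d))))
... | inj₁ a | wrap l e  =
  inj₂ (trans (cong (_+ suc n) e) (trans (cong suc (trans (sym l) a)) (sym (ℕ.+-suc (toℕ x) d))))
... | inj₂ b | inner _ e = inj₂ (trans (cong (_+ suc n) e) (trans (cong suc b) (sym (ℕ.+-suc (toℕ x) d))))
... | inj₂ b | wrap l e  = ⊥-elim (ℕ.<-irrefl (sym b) (ℕ.+-mono-≤-< x≤n+ (ℕ.<-trans (ℕ.n<1+n d) d<n)))
  where
  x≤n+ : toℕ x ≤ toℕ (shift d x)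
  x≤n+ = ℕ.≤-trans (ℕ.≤-pred (Fin.toℕ<n x)) (ℕ.≤-reflexive (sym l))

cancel-weights : ∀ {W W′ d d′ S S′ X} → W + d ≡ S + X → W′ + d′ ≡ S′ + X → W ≡ W′ →
                 S + d′ ≡ S′ + d
cancel-weights {W} {_} {d} {d′} {S} {S′} {X} e e′ refl = ℕ.+-cancelʳ-≡ X _ _ (begin
  S + d′ + X  ≡⟨ swap S d′ X ⟩
  S + X + d′  ≡⟨ cong (_+ d′) e ⟨
  W + d + d′  ≡⟨ swap W d d′ ⟩
  W + d′ + d  ≡⟨ cong (_+ d) e′ ⟩
  S′ + X + d  ≡⟨ swap S′ X d ⟩
  S′ + d + X  ∎)
  where open ≡-Reasoning

x+a+n≢x+b : ∀ x a b {n} → b < n → x + a + n ≢ x + b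
x+a+n≢x+b x a b {n} b<n eq =
  ℕ.<-irrefl (sym eq) (ℕ.<-≤-trans (ℕ.+-monoʳ-< x b<n) (ℕ.+-monoˡ-≤ n (ℕ.m≤m+n x a)))

shift-injectiveˡ : ∀ {n} a b (x : Fin (suc n)) → a < suc n → b < suc n → shift a x ≡ shift b x → a ≡ b
shift-injectiveˡ {n} a b x a<n b<n e with toℕ-shift a x a<n | toℕ-shift b x b<n
... | inj₁ p | inj₁ q = ℕ.+-cancelˡ-≡ (toℕ x) a b (trans (sym p) (trans (cong toℕ e) q))
... | inj₂ p | inj₂ q = ℕ.+-cancelˡ-≡ (toℕ x) a b (trans (sym p) (trans (cong (λ z → toℕ z + suc n) e) q))
... | inj₁ p | inj₂ q =
  ⊥-elim (x+a+n≢x+b (toℕ x) a b b<n (trans (cong (_+ suc n) (trans (sym p) (cong toℕ e))) q))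
... | inj₂ p | inj₁ q =
  ⊥-elim (x+a+n≢x+b (toℕ x) b a a<n (trans (cong (_+ suc n) (trans (sym q) (cong toℕ (sym e)))) p))

-- Of distinct positions, at most one wraps around to 0.
sum-toℕ-next : ∀ {n} (xs : List (Fin (suc n))) → Unique xs →
    sum (map (toℕ ∘ next) xs) ≡ sum (map toℕ xs) + length xs
  ⊎ sum (map (toℕ ∘ next) xs) + suc n ≡ sum (map toℕ xs) + length xs × Any (λ z → toℕ z ≡ n) xs
sum-toℕ-next [] _ = inj₁ refl
sum-toℕ-next {n} (x ∷ xs) (x∉xs ∷ u) with sum-toℕ-next xs u | nextView x
... | inj₁ e | inner _ ex = inj₁ (trans (cong₂ _+_ ex e) (lemma₁ (toℕ x) _ _))
  where
  lemma₁ : ∀ a s l → suc a + (s + l) ≡ a + s + suc l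
  lemma₁ = solve-∀
... | inj₁ e | wrap lx ex = inj₂ (eq , here lx)
  where
  lemma₂ : ∀ a s l → s + l + suc a ≡ a + s + suc l
  lemma₂ = solve-∀
  eq : toℕ (next x) + sum (map (toℕ ∘ next) xs) + suc n ≡ toℕ x + sum (map toℕ xs) + suc (length xs)
  eq = trans (cong (λ z → z + sum (map (toℕ ∘ next) xs) + suc n) ex)
         (trans (cong (_+ suc n) e) (trans (cong (λ z → sum (map toℕ xs) + length xs + suc z) (sym lx))
           (lemma₂ (toℕ x) _ _)))
... | inj₂ (e , w) | inner _ ex = inj₂ (eq , there w)
  where
  lemma₃ : ∀ a s' m s l → s' + m ≡ s + l → suc a + s' + m ≡ a + s + suc l
  lemma₃ a s' m s l h = trans (cong suc (trans (ℕ.+-assoc a s' m) (cong (a +_) h)))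
                              (sym (trans (ℕ.+-suc (a + s) l) (cong suc (ℕ.+-assoc a s l))))
  eq : toℕ (next x) + sum (map (toℕ ∘ next) xs) + suc n ≡ toℕ x + sum (map toℕ xs) + suc (length xs)
  eq rewrite ex = lemma₃ (toℕ x) _ _ _ _ e
... | inj₂ (_ , w) | wrap lx _ = ⊥-elim (two-wraps x∉xs w)
  where
  two-wraps : ∀ {ys} → All (x ≢_) ys → Any (λ z → toℕ z ≡ n) ys → ⊥
  two-wraps (p ∷ _)  (here ly) = p (Fin.toℕ-injective (trans lx (sym ly)))
  two-wraps (_ ∷ ps) (there q) = two-wraps ps q

-- Distinct colours from {1, …, k}

InRange : ℕ → ℕ → Set
InRange k x = 1 ≤ x × x ≤ k

InRange? : ∀ k x → Dec (InRange k x)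
InRange? k x = (1 ℕ.≤? x) ×-dec (x ℕ.≤? k)

≢? : ∀ (x y : ℕ) → Dec (x ≢ y)
≢? x y = ¬? (x ℕ.≟ y)

triangle : ℕ → ℕ
triangle zero    = 0
triangle (suc k) = suc k + triangle k

Unique-resp-↭ : ∀ {A : Set} {xs ys : List A} → xs ↭ ys → Unique xs → Unique ys
Unique-resp-↭ {A} p = ↭ₛ.Unique-resp-↭ (setoid A) (↭.↭⇒↭ₛ p)

∈⇒↭∷ : ∀ {A : Set} {v : A} {xs} → v ∈ xs → ∃ λ ys → xs ↭ v ∷ ys
∈⇒↭∷ {v = v} v∈xs with ∈-∃++ v∈xs
... | ws , zs , refl = ws ++ zs , ↭.shift v ws zs

InRange-pred : ∀ {k x} → InRange (suc k) x → suc k ≢ x → InRange k x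
InRange-pred (1≤x , x≤1+k) 1+k≢x = 1≤x , ℕ.≤-pred (ℕ.≤∧≢⇒< x≤1+k (1+k≢x ∘ sym))

data TopColour (k : ℕ) (xs : List ℕ) : Set where
  present : ∀ {ys} → xs ↭ suc k ∷ ys → Unique ys → All (InRange k) ys → TopColour k xs
  absent  : All (InRange k) xs → TopColour k xs

topColour : ∀ k xs → Unique xs → All (InRange (suc k)) xs → TopColour k xs
topColour k xs u r with Any.any? (suc k ℕ.≟_) xs
... | yes 1+k∈xs with ∈⇒↭∷ 1+k∈xs
...   | ys , p with Unique-resp-↭ p u | ↭.All-resp-↭ p r
...     | 1+k∉ys ∷ u′ | _ ∷ r′ = present p u′ (All.zipWith (λ (q , ≢) → InRange-pred q ≢) (r′ , 1+k∉ys))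
topColour k xs u r | no 1+k∉xs =
  absent (All.zipWith (λ (q , ≢) → InRange-pred q ≢) (r , All.¬Any⇒All¬ xs 1+k∉xs))

length-distinct≤ : ∀ k xs → Unique xs → All (InRange k) xs → length xs ≤ k
length-distinct≤ zero [] _ _ = z≤n
length-distinct≤ zero (x ∷ _) _ ((1≤x , x≤0) ∷ _) = ⊥-elim (ℕ.<-irrefl refl (ℕ.≤-trans 1≤x x≤0))
length-distinct≤ (suc k) xs u r with topColour k xs u r
... | present {ys} p u′ r′ =
  ℕ.≤-trans (ℕ.≤-reflexive (↭.↭-length p)) (s≤s (length-distinct≤ k ys u′ r′))
... | absent r′ = ℕ.≤-trans (length-distinct≤ k xs u r′) (ℕ.n≤1+n k)

sum-distinct≡triangle : ∀ k xs → Unique xs → All (InRange k) xs → length xs ≡ k → sum xs ≡ triangle k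
sum-distinct≡triangle zero [] _ _ _ = refl
sum-distinct≡triangle (suc k) xs u r len with topColour k xs u r
... | present {ys} p u′ r′ =
  trans (sum-↭ p) (cong (suc k +_)
    (sum-distinct≡triangle k ys u′ r′ (ℕ.suc-injective (trans (sym (↭.↭-length p)) len))))
... | absent r′ = ⊥-elim (ℕ.<-irrefl len (s≤s (length-distinct≤ k xs u r′)))

record Neighbourhood (G : Graph) (x : Fin (V G)) (ys : List (Fin (V G))) : Set where
  field
    unique   : Unique ys
    sound    : ∀ {y} → y ∈ ys → Adj G x y
    complete : ∀ {y} → Adj G x y → y ∈ ys
open Neighbourhood public

Unique-map⁺ : ∀ {A B : Set} (f : A → B) {xs} → Unique xs →
  (∀ {v w} → v ∈ xs → w ∈ xs → v ≢ w → f v ≢ f w) → Unique (map f xs)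
Unique-map⁺ f [] _ = []
Unique-map⁺ f (x∉xs ∷ u) f≢ =
  All.map⁺ (All.tabulate (λ w∈ → f≢ (here refl) (there w∈) (All.lookup x∉xs w∈)))
  ∷ Unique-map⁺ f u (λ v∈ w∈ → f≢ (there v∈) (there w∈))

map-unique⇒≢ : ∀ {A B : Set} (f : A → B) {xs v w} →
               Unique (map f xs) → v ∈ xs → w ∈ xs → v ≢ w → f v ≢ f w
map-unique⇒≢ f (_ ∷ _)     (here refl) (here refl) v≢w = ⊥-elim (v≢w refl)
map-unique⇒≢ f (fx∉ ∷ _)   (here refl) (there w∈)  _   = All.lookup fx∉ (∈-map⁺ f w∈)
map-unique⇒≢ f (fx∉ ∷ _)   (there v∈)  (here refl) _   = All.lookup fx∉ (∈-map⁺ f v∈) ∘ sym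
map-unique⇒≢ f (_ ∷ u)     (there v∈)  (there w∈)  v≢w = map-unique⇒≢ f u v∈ w∈ v≢w

sum-filter≤ : ∀ {A : Set} {P : A → Set} (P? : ∀ x → Dec (P x)) (f : A → ℕ) xs →
  sum (map f (filter P? xs)) ≤ sum (map f xs)
sum-filter≤ P? f [] = z≤n
sum-filter≤ P? f (x ∷ xs) with does (P? x)
... | true  = ℕ.+-monoʳ-≤ (f x) (sum-filter≤ P? f xs)
... | false = ℕ.≤-trans (sum-filter≤ P? f xs) (ℕ.m≤n+m _ (f x))

sum-unique≤sum-allFin : ∀ {n} (f : Fin n → ℕ) {xs} → Unique xs → sum (map f xs) ≤ sum (map f (allFin n))
sum-unique≤sum-allFin {n} f {xs} u = subst (_≤ sum (map f (allFin n))) (sum-↭ (↭.map⁺ f filter↭xs))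
  (sum-filter≤ ∈xs? f (allFin n))
  where
  ∈xs? : ∀ y → Dec (y ∈ xs)
  ∈xs? y = Any.any? (y Fin.≟_) xs
  filter↭xs : filter ∈xs? (allFin n) ↭ xs
  filter↭xs = ∼bag⇒↭ (unique∧set⇒bag (Unique.filter⁺ ∈xs? (Unique.allFin⁺ n)) u
    (mk⇔ (proj₂ ∘ ∈-filter⁻ ∈xs? {xs = allFin n}) (∈-filter⁺ ∈xs? (∈-allFin _))))

module _ (G : Graph) (x : Fin (V G)) where

  adj? : ∀ w → Dec (Adj G x w)
  adj? w = adj G x w ≟ᵇ true

  neighbours : List (Fin (V G))
  neighbours = filter adj? (allFin (V G))

  neighbourhood-neighbours : Neighbourhood G x neighbours
  neighbourhood-neighbours = record
    { unique   = Unique.filter⁺ adj? (Unique.allFin⁺ (V G))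
    ; sound    = proj₂ ∘ ∈-filter⁻ adj? {xs = allFin (V G)}
    ; complete = ∈-filter⁺ adj? (∈-allFin _)
    }

  neighbours↭ : ∀ {ys} → Neighbourhood G x ys → neighbours ↭ ys
  neighbours↭ N = ∼bag⇒↭ (unique∧set⇒bag (unique neighbourhood-neighbours) (unique N)
    (mk⇔ (complete N ∘ sound neighbourhood-neighbours) (complete neighbourhood-neighbours ∘ sound N)))

  degree-neighbourhood : ∀ {ys} → Neighbourhood G x ys → degree G x ≡ length ys
  degree-neighbourhood N = ↭.↭-length (neighbours↭ N)

  sum-if-adj : ∀ (f : Fin (V G) → ℕ) ws →
    sum (map (λ w → if adj G x w then f w else 0) ws) ≡ sum (map f (filter adj? ws))
  sum-if-adj f [] = refl
  sum-if-adj f (w ∷ ws) with adj G x w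
  ... | true  = cong (f w +_) (sum-if-adj f ws)
  ... | false = sum-if-adj f ws

  weight-neighbourhood : ∀ (c : TotalColoring G) {ys} → Neighbourhood G x ys →
    weight G c x ≡ vcol c x + sum (map (ecol c x) ys)
  weight-neighbourhood c N = cong (vcol c x +_)
    (trans (sum-if-adj (ecol c x) (allFin (V G))) (sum-↭ (↭.map⁺ (ecol c x) (neighbours↭ N))))

  module _ {k} {c : TotalColoring G} (proper : IsProperTotal G k c) where

    incidentColours : List ℕ
    incidentColours = vcol c x ∷ map (ecol c x) neighbours

    unique-incidentColours : Unique incidentColours
    unique-incidentColours =
      All.map⁺ (All.tabulate λ y∈ e → proj₁ (edge≢ends x _ (sound neighbourhood-neighbours y∈)) (sym e))
      ∷ Unique-map⁺ (ecol c x) (unique neighbourhood-neighbours)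
          (λ v∈ w∈ → edges≢ x _ _ (sound neighbourhood-neighbours v∈) (sound neighbourhood-neighbours w∈))
      where
      edge≢ends = proj₁ (proj₂ (proj₂ (proj₂ (proj₂ proper))))
      edges≢ = proj₂ (proj₂ (proj₂ (proj₂ (proj₂ proper))))

    incidentColours-in-range : All (InRange k) incidentColours
    incidentColours-in-range = proj₁ proper x
      ∷ All.map⁺ (All.tabulate λ y∈ → proj₁ (proj₂ proper) x _ (sound neighbourhood-neighbours y∈))

    length-incidentColours : length incidentColours ≡ suc (degree G x)
    length-incidentColours = cong suc (List.length-map (ecol c x) neighbours)

    suc-degree≤ : suc (degree G x) ≤ k
    suc-degree≤ = subst (_≤ k) length-incidentColours
      (length-distinct≤ k incidentColours unique-incidentColours incidentColours-in-range)

    weight≡triangle : suc (degree G x) ≡ k → weight G c x ≡ triangle k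
    weight≡triangle tight = trans (cong (vcol c x +_) (sum-if-adj (ecol c x) (allFin (V G))))
      (sum-distinct≡triangle k incidentColours unique-incidentColours incidentColours-in-range
        (trans length-incidentColours tight))

data Class : Set where
  even odd last : Class

parity : ℕ → Class
parity zero          = even
parity (suc zero)    = odd
parity (suc (suc t)) = parity t

classAt : ℕ → ℕ → Class
classAt n t = if ⌊ suc t ℕ.≟ n ⌋ then last else parity t

-- Positions alternate between even and odd, except that the last one gets a class of its own;
-- this way consecutive positions get different classes whatever the parity of n.
class : ∀ {n} → Fin n → Class
class {n} j = classAt n (toℕ j)

classAt-last : ∀ {n t} → suc t ≡ n → classAt n t ≡ last
classAt-last {n} {t} e = cong (if_then last else parity t) (⌊⌋-true (suc t ℕ.≟ n) e)

classAt-parity : ∀ {n t} → suc t ≢ n → classAt n t ≡ parity t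
classAt-parity {n} {t} ne = cong (if_then last else parity t) (⌊⌋-false (suc t ℕ.≟ n) ne)

data Alternate : Class → Class → Set where
  even-odd : Alternate even odd
  odd-even : Alternate odd even

alternate : ∀ t → Alternate (parity t) (parity (suc t))
alternate zero          = even-odd
alternate (suc zero)    = odd-even
alternate (suc (suc t)) = alternate t

data Window : Class → Class → Class → Set where
  even-odd-even  : Window even odd even
  odd-even-odd   : Window odd even odd
  even-odd-last  : Window even odd last
  odd-even-last  : Window odd even last
  last-even-odd  : Window last even odd
  even-last-even : Window even last even
  odd-last-even  : Window odd last even

Window-cong : ∀ {q q′ r r′ s s′} → q ≡ q′ → r ≡ r′ → s ≡ s′ → Window q′ r′ s′ → Window q r s
Window-cong refl refl refl w = w

window : ∀ {n} (j : Fin (3 + n)) → Window (class (prev j)) (class j) (class (next j))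
window {n} j with nextView (prev j) | nextView j
... | wrap p≡ p⁺≡0 | inner _ j⁺≡ =
  Window-cong (classAt-last (cong suc p≡)) (cong (classAt _) j≡0) (cong (classAt _) (trans j⁺≡ (cong suc j≡0)))
    last-even-odd
  where
  j≡0 : toℕ j ≡ 0
  j≡0 = trans (cong toℕ (sym (next-prev j))) p⁺≡0
... | wrap _ p⁺≡0 | wrap j≡ _ = ⊥-elim (suc≢0 (trans (sym j≡) (trans (cong toℕ (sym (next-prev j))) p⁺≡0)))
... | inner p< p⁺≡ | wrap j≡ j⁺≡0 =
  Window-cong (classAt-parity (ℕ.<⇒≢ p<)) (classAt-last (cong suc j≡)) (cong (classAt _) j⁺≡0)
    (into-last (alternate (toℕ (prev j))))
  where
  into-last : ∀ {p q} → Alternate p q → Window p last even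
  into-last even-odd = even-last-even
  into-last odd-even = odd-last-even
... | inner p< p⁺≡ | inner j< j⁺≡ = depending-on-next (suc (toℕ (next j)) ℕ.≟ 3 + n)
  where
  t = toℕ (prev j)
  j≡ : toℕ j ≡ suc t
  j≡ = trans (cong toℕ (sym (next-prev j))) p⁺≡
  e₁ = classAt-parity (ℕ.<⇒≢ p<)
  e₂ = trans (classAt-parity (ℕ.<⇒≢ j<)) (cong parity j≡)
  before-last : ∀ {p q} → Alternate p q → Window p q last
  before-last even-odd = even-odd-last
  before-last odd-even = odd-even-last
  alternating : ∀ {p q} → Alternate p q → Window p q p
  alternating even-odd = even-odd-even
  alternating odd-even = odd-even-odd
  depending-on-next : Dec (suc (toℕ (next j)) ≡ 3 + n) → Window (class (prev j)) (class j) (class (next j))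
  depending-on-next (yes l) = Window-cong e₁ e₂ (classAt-last l) (before-last (alternate t))
  depending-on-next (no l)  =
    Window-cong e₁ e₂ (trans (classAt-parity l) (cong parity (trans j⁺≡ (cong suc j≡)))) (alternating (alternate t))

-- Colours of row j as tables indexed by the classes of j - 1 and j and by the column

record Tables (m : ℕ) : Set where
  field
    vertexTable   : Class → Class → Vec ℕ (suc m)
    spokeTable    : Class → Class → Vec ℕ m
    rimTable      : Class → Class → Vec ℕ m
    verticalTable : Class → ℕ

-- The graph W_m □ C_n in coordinates

∧∨-true : ∀ x y z w → (x ∧ y) ∨ (z ∧ w) ≡ true → (x ≡ true × y ≡ true) ⊎ (z ≡ true × w ≡ true)
∧∨-true true  true  _     _     _ = inj₁ (refl , refl)
∧∨-true true  false true  true  _ = inj₂ (refl , refl)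
∧∨-true false _     true  true  _ = inj₂ (refl , refl)
∧∨-true true  false true  false ()
∧∨-true true  false false _     ()
∧∨-true false _     true  false ()
∧∨-true false _     false _     ()

module WheelCycle (m₀ n₀ : ℕ) where
  m n : ℕ
  m = 3 + m₀
  n = 3 + n₀

  G : Graph
  G = wheel m □ cycle n

  ⟨_,_⟩ : Fin (suc m) → Fin n → Fin (V G)
  ⟨ a , j ⟩ = combine a j

  coordinates : ∀ x → ∃ λ a → ∃ λ j → x ≡ ⟨ a , j ⟩
  coordinates x = proj₁ (remQuot {suc m} n x) , proj₂ (remQuot {suc m} n x) , sym (Fin.combine-remQuot {suc m} n x)

  adj-⟨⟩ : ∀ a j b k →
    adj G ⟨ a , j ⟩ ⟨ b , k ⟩ ≡ (⌊ a Fin.≟ b ⌋ ∧ cycleAdj n j k) ∨ (wheelAdj m a b ∧ ⌊ j Fin.≟ k ⌋)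
  adj-⟨⟩ a j b k = cong₂ (λ p q → (⌊ proj₁ p Fin.≟ proj₁ q ⌋ ∧ cycleAdj n (proj₂ p) (proj₂ q))
                                ∨ (wheelAdj m (proj₁ p) (proj₁ q) ∧ ⌊ proj₂ p Fin.≟ proj₂ q ⌋))
                         (Fin.remQuot-combine a j) (Fin.remQuot-combine b k)

  adj-vertical : ∀ a {j k} → cycleAdj n j k ≡ true → Adj G ⟨ a , j ⟩ ⟨ a , k ⟩
  adj-vertical a {j} {k} h = trans (adj-⟨⟩ a j a k)
    (cong₂ (λ x y → (x ∧ y) ∨ (wheelAdj m a a ∧ ⌊ j Fin.≟ k ⌋)) (⌊⌋-true (a Fin.≟ a) refl) h)

  adj-horizontal : ∀ a b j → wheelAdj m a b ≡ true → Adj G ⟨ a , j ⟩ ⟨ b , j ⟩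
  adj-horizontal a b j h = trans (adj-⟨⟩ a j b j)
    (trans (cong₂ (λ x y → (⌊ a Fin.≟ b ⌋ ∧ cycleAdj n j j) ∨ (x ∧ y)) h (⌊⌋-true (j Fin.≟ j) refl))
           (∨-zeroʳ _))

  data Step : Fin (suc m) → Fin n → Fin (V G) → Set where
    up      : ∀ a j → Step a j ⟨ a , next j ⟩
    down    : ∀ a j → Step a j ⟨ a , prev j ⟩
    outward : ∀ i j → Step fzero j ⟨ fsuc i , j ⟩
    inward  : ∀ i j → Step (fsuc i) j ⟨ fzero , j ⟩
    right   : ∀ i j → Step (fsuc i) j ⟨ fsuc (next i) , j ⟩
    left    : ∀ i j → Step (fsuc i) j ⟨ fsuc (prev i) , j ⟩

  Step⇒Adj : ∀ {a j y} → Step a j y → Adj G ⟨ a , j ⟩ y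
  Step⇒Adj (up a j)      = adj-vertical a (cycleAdj-next j)
  Step⇒Adj (down a j)    = adj-vertical a (cycleAdj-prev j)
  Step⇒Adj (outward i j) = adj-horizontal fzero (fsuc i) j refl
  Step⇒Adj (inward i j)  = adj-horizontal (fsuc i) fzero j refl
  Step⇒Adj (right i j)   = adj-horizontal (fsuc i) (fsuc (next i)) j (cycleAdj-next i)
  Step⇒Adj (left i j)    = adj-horizontal (fsuc i) (fsuc (prev i)) j (cycleAdj-prev i)

  Adj⇒Step : ∀ a j b k → Adj G ⟨ a , j ⟩ ⟨ b , k ⟩ → Step a j ⟨ b , k ⟩
  Adj⇒Step a j b k h with ∧∨-true ⌊ a Fin.≟ b ⌋ (cycleAdj n j k) (wheelAdj m a b) ⌊ j Fin.≟ k ⌋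
                                  (trans (sym (adj-⟨⟩ a j b k)) h)
  ... | inj₁ (a≡b , j~k) with ⌊⌋-witness (a Fin.≟ b) a≡b | cycleAdj⇒next⊎prev j k j~k
  ...   | refl | inj₁ refl = up a j
  ...   | refl | inj₂ refl = down a j
  Adj⇒Step a j b k h | inj₂ (a~b , j≡k) with ⌊⌋-witness (j Fin.≟ k) j≡k
  Adj⇒Step fzero    j (fsuc i) _ h | inj₂ (a~b , _) | refl = outward i j
  Adj⇒Step (fsuc i) j fzero    _ h | inj₂ (a~b , _) | refl = inward i j
  Adj⇒Step (fsuc i) j (fsuc i′) _ h | inj₂ (a~b , _) | refl with cycleAdj⇒next⊎prev i i′ a~b
  ... | inj₁ refl = right i j
  ... | inj₂ refl = left i j

  Step⇒Adj⁻¹ : ∀ {a j y} → Step a j y → Adj G y ⟨ a , j ⟩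
  Step⇒Adj⁻¹ (up a j)      = adj-vertical a (cycleAdj-next⁻¹ j)
  Step⇒Adj⁻¹ (down a j)    = adj-vertical a (cycleAdj-prev⁻¹ j)
  Step⇒Adj⁻¹ (outward i j) = adj-horizontal (fsuc i) fzero j refl
  Step⇒Adj⁻¹ (inward i j)  = adj-horizontal fzero (fsuc i) j refl
  Step⇒Adj⁻¹ (right i j)   = adj-horizontal (fsuc (next i)) (fsuc i) j (cycleAdj-next⁻¹ i)
  Step⇒Adj⁻¹ (left i j)    = adj-horizontal (fsuc (prev i)) (fsuc i) j (cycleAdj-prev⁻¹ i)

  neighbourList : Fin (suc m) → Fin n → List (Fin (V G))
  neighbourList fzero    j = ⟨ fzero , next j ⟩ ∷ ⟨ fzero , prev j ⟩ ∷ map (λ i → ⟨ fsuc i , j ⟩) (allFin m)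
  neighbourList (fsuc i) j = ⟨ fsuc i , next j ⟩ ∷ ⟨ fsuc i , prev j ⟩ ∷ ⟨ fzero , j ⟩
                           ∷ ⟨ fsuc (next i) , j ⟩ ∷ ⟨ fsuc (prev i) , j ⟩ ∷ []

  ∈⇒Step : ∀ a j {y} → y ∈ neighbourList a j → Step a j y
  ∈⇒Step fzero j (here refl)         = up fzero j
  ∈⇒Step fzero j (there (here refl)) = down fzero j
  ∈⇒Step fzero j (there (there y∈)) with ∈-map⁻ (λ i → ⟨ fsuc i , j ⟩) {xs = allFin m} y∈
  ... | i , _ , refl = outward i j
  ∈⇒Step (fsuc i) j (here refl)                                 = up (fsuc i) j
  ∈⇒Step (fsuc i) j (there (here refl))                         = down (fsuc i) j
  ∈⇒Step (fsuc i) j (there (there (here refl)))                 = inward i j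
  ∈⇒Step (fsuc i) j (there (there (there (here refl))))         = right i j
  ∈⇒Step (fsuc i) j (there (there (there (there (here refl))))) = left i j

  Step⇒∈ : ∀ {a j y} → Step a j y → y ∈ neighbourList a j
  Step⇒∈ (up fzero j)      = here refl
  Step⇒∈ (up (fsuc i) j)   = here refl
  Step⇒∈ (down fzero j)    = there (here refl)
  Step⇒∈ (down (fsuc i) j) = there (here refl)
  Step⇒∈ (outward i j)     = there (there (∈-map⁺ (λ i → ⟨ fsuc i , j ⟩) (∈-allFin i)))
  Step⇒∈ (inward i j)      = there (there (here refl))
  Step⇒∈ (right i j)       = there (there (there (here refl)))
  Step⇒∈ (left i j)        = there (there (there (there (here refl))))

  ⟨⟩≢ : ∀ a b j k → a ≢ b ⊎ j ≢ k → ⟨ a , j ⟩ ≢ ⟨ b , k ⟩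
  ⟨⟩≢ a b j k (inj₁ a≢b) e = a≢b (proj₁ (Fin.combine-injective a j b k e))
  ⟨⟩≢ a b j k (inj₂ j≢k) e = j≢k (proj₂ (Fin.combine-injective a j b k e))

  hub≢rim : ∀ {i : Fin m} → fzero ≢ fsuc i
  hub≢rim ()

  unique-neighbourList : ∀ a j → Unique (neighbourList a j)
  unique-neighbourList fzero j =
      (⟨⟩≢ fzero fzero (next j) (prev j) (inj₂ (next≢prev j)) ∷ All.tabulate (off-hub (next j)))
    ∷ All.tabulate (off-hub (prev j))
    ∷ Unique.map⁺ (λ {i} {i′} e → Fin.suc-injective (proj₁ (Fin.combine-injective (fsuc i) j (fsuc i′) j e)))
                  (Unique.allFin⁺ m)
    where
    off-hub : ∀ k {y} → y ∈ map (λ i → ⟨ fsuc i , j ⟩) (allFin m) → ⟨ fzero , k ⟩ ≢ y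
    off-hub k y∈ with ∈-map⁻ (λ i → ⟨ fsuc i , j ⟩) {xs = allFin m} y∈
    ... | i , _ , refl = ⟨⟩≢ fzero (fsuc i) k j (inj₁ hub≢rim)
  unique-neighbourList (fsuc i) j =
      (≢-vertical (next j) (prev j) (next≢prev j) ∷ ≢-hub (next j)
       ∷ ≢-rim (next i) (next j) (next≢id j) ∷ ≢-rim (prev i) (next j) (next≢id j) ∷ [])
    ∷ (≢-hub (prev j) ∷ ≢-rim (next i) (prev j) (prev≢id j) ∷ ≢-rim (prev i) (prev j) (prev≢id j) ∷ [])
    ∷ (⟨⟩≢ fzero (fsuc (next i)) j j (inj₁ hub≢rim)
       ∷ ⟨⟩≢ fzero (fsuc (prev i)) j j (inj₁ hub≢rim) ∷ [])
    ∷ (⟨⟩≢ (fsuc (next i)) (fsuc (prev i)) j j (inj₁ (next≢prev i ∘ Fin.suc-injective)) ∷ [])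
    ∷ [] ∷ []
    where
    ≢-vertical : ∀ k k′ → k ≢ k′ → ⟨ fsuc i , k ⟩ ≢ ⟨ fsuc i , k′ ⟩
    ≢-vertical k k′ k≢k′ = ⟨⟩≢ (fsuc i) (fsuc i) k k′ (inj₂ k≢k′)
    ≢-rim : ∀ i′ k → k ≢ j → ⟨ fsuc i , k ⟩ ≢ ⟨ fsuc i′ , j ⟩
    ≢-rim i′ k k≢j = ⟨⟩≢ (fsuc i) (fsuc i′) k j (inj₂ k≢j)
    ≢-hub : ∀ k → ⟨ fsuc i , k ⟩ ≢ ⟨ fzero , j ⟩
    ≢-hub k = ⟨⟩≢ (fsuc i) fzero k j (inj₁ (hub≢rim ∘ sym))

  neighbourhood : ∀ a j → Neighbourhood G ⟨ a , j ⟩ (neighbourList a j)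
  neighbourhood a j = record
    { unique   = unique-neighbourList a j
    ; sound    = Step⇒Adj ∘ ∈⇒Step a j
    ; complete = complete′
    }
    where
    complete′ : ∀ {y} → Adj G ⟨ a , j ⟩ y → y ∈ neighbourList a j
    complete′ {y} h with coordinates y
    ... | b , k , refl = Step⇒∈ (Adj⇒Step a j b k h)

  degree-hub : ∀ j → degree G ⟨ fzero , j ⟩ ≡ 2 + m
  degree-hub j = trans (degree-neighbourhood G ⟨ fzero , j ⟩ (neighbourhood fzero j))
    (cong (2 +_) (trans (List.length-map (λ i → ⟨ fsuc i , j ⟩) (allFin m)) (List.length-tabulate id)))

  degree≤ : ∀ x → degree G x ≤ 2 + m
  degree≤ x = subst (λ z → degree G z ≤ 2 + m) (sym x≡) (degree-⟨⟩≤ a j)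
    where
    a = proj₁ (coordinates x)
    j = proj₁ (proj₂ (coordinates x))
    x≡ = proj₂ (proj₂ (coordinates x))
    degree-⟨⟩≤ : ∀ a j → degree G ⟨ a , j ⟩ ≤ 2 + m
    degree-⟨⟩≤ fzero    j = ℕ.≤-reflexive (degree-hub j)
    degree-⟨⟩≤ (fsuc i) j =
      ℕ.≤-trans (ℕ.≤-reflexive (degree-neighbourhood G ⟨ fsuc i , j ⟩ (neighbourhood (fsuc i) j)))
                (ℕ.+-monoʳ-≤ 2 (s≤s (s≤s (s≤s z≤n))))

  maxDegree≡ : maxDegree G ≡ 2 + m
  maxDegree≡ = ℕ.≤-antisym
    (List.foldr-preservesᵇ {P = _≤ 2 + m} ℕ.⊔-lub z≤n
      (All.map⁺ {xs = allFin (V G)} (All.tabulate λ {x} _ → degree≤ x)))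
    (List.foldr-preservesᵒ {P = 2 + m ≤_} ⊔-either 0 (map (degree G) (allFin (V G)))
      (inj₂ (Any.map (λ e → ℕ.≤-reflexive (trans (sym (degree-hub fzero)) e))
                     (∈-map⁺ (degree G) (∈-allFin ⟨ fzero , fzero ⟩)))))
    where
    ⊔-either : ∀ x y → 2 + m ≤ x ⊎ 2 + m ≤ y → 2 + m ≤ x ⊔ y
    ⊔-either x y (inj₁ h) = ℕ.m≤n⇒m≤n⊔o y h
    ⊔-either x y (inj₂ h) = ℕ.m≤n⇒m≤o⊔n x h


  lower-bound : ∀ {k} → HasNSDTC G k → m + 4 ≤ k
  lower-bound {k} (c , proper , distinguishes) = subst (_≤ k) (ℕ.+-comm 4 m) (ℕ.≤∧≢⇒< m+3≤k m+3≢k)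
    where
    hub-degree : ∀ j → suc (degree G ⟨ fzero , j ⟩) ≡ 3 + m
    hub-degree j = cong suc (degree-hub j)
    m+3≤k : 3 + m ≤ k
    m+3≤k = subst (_≤ k) (hub-degree fzero) (suc-degree≤ G ⟨ fzero , fzero ⟩ proper)
    -- with only m + 3 colours every hub vertex has weight 1 + 2 + ⋯ + (m + 3)
    m+3≢k : 3 + m ≢ k
    m+3≢k tight = distinguishes ⟨ fzero , fzero ⟩ ⟨ fzero , next fzero ⟩ (Step⇒Adj (up fzero fzero))
      (trans (weight≡triangle G ⟨ fzero , fzero ⟩ proper (trans (hub-degree fzero) tight))
        (sym (weight≡triangle G ⟨ fzero , next fzero ⟩ proper (trans (hub-degree (next fzero)) tight))))

  data Edge : Fin (V G) → Fin (V G) → Set where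
    along : ∀ {a j y} → Step a j y → Edge ⟨ a , j ⟩ y

  Adj⇒Edge : ∀ {x y} → Adj G x y → Edge x y
  Adj⇒Edge {x} {y} h with coordinates x | coordinates y
  ... | a , j , refl | b , k , refl = along (Adj⇒Step a j b k h)

  Adj-sym : ∀ {x y} → Adj G x y → Adj G y x
  Adj-sym {x} {y} h with Adj⇒Edge {x} {y} h
  ... | along s = Step⇒Adj⁻¹ s

  record Separates (f : Fin (suc m) → Fin n → ℕ) : Set where
    field
      across-spoke : ∀ i j → f fzero j ≢ f (fsuc i) j
      across-rim   : ∀ i j → f (fsuc i) j ≢ f (fsuc (next i)) j
      across-cycle : ∀ a j → f a j ≢ f a (next j)

  separated : ∀ {f} → Separates f → (g : Fin (V G) → ℕ) → (∀ a j → g ⟨ a , j ⟩ ≡ f a j) →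
              ∀ {x y} → Adj G x y → g x ≢ g y
  separated {f} sep g g≡f {x} {y} h with Adj⇒Edge {x} {y} h
  ... | along {a} {j} s = λ e → differ s (trans (sym (g≡f a j)) e)
    where
    open Separates sep
    differ : ∀ {a j y} → Step a j y → f a j ≢ g y
    differ (up a j)      e = across-cycle a j (trans e (g≡f a (next j)))
    differ (down a j)    e = across-cycle a (prev j)
                               (sym (trans (cong (f a) (next-prev j)) (trans e (g≡f a (prev j)))))
    differ (outward i j) e = across-spoke i j (trans e (g≡f (fsuc i) j))
    differ (inward i j)  e = across-spoke i j (sym (trans e (g≡f fzero j)))
    differ (right i j)   e = across-rim i j (trans e (g≡f (fsuc (next i)) j))
    differ (left i j)    e = across-rim (prev i) j
                               (sym (trans (cong (λ z → f (fsuc z) j) (next-prev i)) (trans e (g≡f (fsuc (prev i)) j))))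

  -- spoke i j, rim i j and vertical a j colour the edges ⟨ 0 , j ⟩ ⟨ i + 1 , j ⟩, ⟨ i + 1 , j ⟩ ⟨ next i + 1 , j ⟩
  -- and ⟨ a , j ⟩ ⟨ a , next j ⟩ respectively; edge gives junk colours to pairs that are not edges.
  record Scheme : Set where
    field
      vertex   : Fin (suc m) → Fin n → ℕ
      spoke    : Fin m → Fin n → ℕ
      rim      : Fin m → Fin n → ℕ
      vertical : Fin (suc m) → Fin n → ℕ

  module _ (S : Scheme) where
    open Scheme S

    horizontal : Fin (suc m) → Fin (suc m) → Fin n → ℕ
    horizontal fzero    fzero     j = 0
    horizontal fzero    (fsuc i)  j = spoke i j
    horizontal (fsuc i) fzero     j = spoke i j
    horizontal (fsuc i) (fsuc i′) j = if ⌊ i′ Fin.≟ next i ⌋ then rim i j else rim i′ j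

    edge : Fin (suc m) × Fin n → Fin (suc m) × Fin n → ℕ
    edge (a , j) (b , k) =
      if ⌊ a Fin.≟ b ⌋ then (if ⌊ k Fin.≟ next j ⌋ then vertical a j else vertical a k) else horizontal a b j

    colouring : TotalColoring G
    colouring = record
      { vcol = λ x → uncurry vertex (remQuot {suc m} n x)
      ; ecol = λ x y → edge (remQuot {suc m} n x) (remQuot {suc m} n y)
      }

    vcol-⟨⟩ : ∀ a j → vcol colouring ⟨ a , j ⟩ ≡ vertex a j
    vcol-⟨⟩ a j = cong (uncurry vertex) (Fin.remQuot-combine a j)

    ecol-⟨⟩ : ∀ a j b k → ecol colouring ⟨ a , j ⟩ ⟨ b , k ⟩ ≡ edge (a , j) (b , k)
    ecol-⟨⟩ a j b k = cong₂ edge (Fin.remQuot-combine a j) (Fin.remQuot-combine b k)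

    edge-vertical : ∀ a j k → edge (a , j) (a , k) ≡ (if ⌊ k Fin.≟ next j ⌋ then vertical a j else vertical a k)
    edge-vertical a j k =
      cong (λ c → if c then (if ⌊ k Fin.≟ next j ⌋ then vertical a j else vertical a k) else horizontal a a j)
           (⌊⌋-true (a Fin.≟ a) refl)

    edge-horizontal : ∀ {a b} j k → a ≢ b → edge (a , j) (b , k) ≡ horizontal a b j
    edge-horizontal {a} {b} j k a≢b =
      cong (λ c → if c then (if ⌊ k Fin.≟ next j ⌋ then vertical a j else vertical a k) else horizontal a b j)
           (⌊⌋-false (a Fin.≟ b) a≢b)

    stepColour : ∀ {a j y} → Step a j y → ℕ
    stepColour (up a j)      = vertical a j
    stepColour (down a j)    = vertical a (prev j)
    stepColour (outward i j) = spoke i j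
    stepColour (inward i j)  = spoke i j
    stepColour (right i j)   = rim i j
    stepColour (left i j)    = rim (prev i) j

    ecol-Step : ∀ {a j y} (s : Step a j y) → ecol colouring ⟨ a , j ⟩ y ≡ stepColour s
    ecol-Step (up a j) = trans (ecol-⟨⟩ a j a (next j))
      (trans (edge-vertical a j (next j)) (if-yes (next j Fin.≟ next j) refl))
    ecol-Step (down a j) = trans (ecol-⟨⟩ a j a (prev j))
      (trans (edge-vertical a j (prev j)) (if-no (prev j Fin.≟ next j) (next≢prev j ∘ sym)))
    ecol-Step (outward i j) = ecol-⟨⟩ fzero j (fsuc i) j
    ecol-Step (inward i j)  = ecol-⟨⟩ (fsuc i) j fzero j
    ecol-Step (right i j) = trans (ecol-⟨⟩ (fsuc i) j (fsuc (next i)) j)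
      (trans (edge-horizontal j j (next≢id i ∘ sym ∘ Fin.suc-injective)) (if-yes (next i Fin.≟ next i) refl))
    ecol-Step (left i j) = trans (ecol-⟨⟩ (fsuc i) j (fsuc (prev i)) j)
      (trans (edge-horizontal j j (prev≢id i ∘ sym ∘ Fin.suc-injective))
             (if-no (prev i Fin.≟ next i) (next≢prev i ∘ sym)))

    ecol-Step⁻¹ : ∀ {a j y} (s : Step a j y) → ecol colouring y ⟨ a , j ⟩ ≡ stepColour s
    ecol-Step⁻¹ (up a j) = trans (ecol-⟨⟩ a (next j) a j)
      (trans (edge-vertical a (next j) j) (if-no (j Fin.≟ next (next j)) (next²≢id j ∘ sym)))
    ecol-Step⁻¹ (down a j) = trans (ecol-⟨⟩ a (prev j) a j)
      (trans (edge-vertical a (prev j) j) (if-yes (j Fin.≟ next (prev j)) (sym (next-prev j))))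
    ecol-Step⁻¹ (outward i j) = ecol-⟨⟩ (fsuc i) j fzero j
    ecol-Step⁻¹ (inward i j)  = ecol-⟨⟩ fzero j (fsuc i) j
    ecol-Step⁻¹ (right i j) = trans (ecol-⟨⟩ (fsuc (next i)) j (fsuc i) j)
      (trans (edge-horizontal j j (next≢id i ∘ Fin.suc-injective))
             (if-no (i Fin.≟ next (next i)) (next²≢id i ∘ sym)))
    ecol-Step⁻¹ (left i j) = trans (ecol-⟨⟩ (fsuc (prev i)) j (fsuc i) j)
      (trans (edge-horizontal j j (prev≢id i ∘ Fin.suc-injective)) (if-yes (i Fin.≟ next (prev i)) (sym (next-prev i))))

    incident : Fin (suc m) → Fin n → List ℕ
    incident fzero    j = vertical fzero j ∷ vertical fzero (prev j) ∷ map (λ i → spoke i j) (allFin m)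
    incident (fsuc i) j = vertical (fsuc i) j ∷ vertical (fsuc i) (prev j) ∷ spoke i j ∷ rim i j ∷ rim (prev i) j ∷ []

    map-ecol≡incident : ∀ a j → map (ecol colouring ⟨ a , j ⟩) (neighbourList a j) ≡ incident a j
    map-ecol≡incident fzero j = cong₂ _∷_ (ecol-Step (up fzero j)) (cong₂ _∷_ (ecol-Step (down fzero j))
      (trans (sym (List.map-∘ (allFin m))) (List.map-cong (λ i → ecol-Step (outward i j)) (allFin m))))
    map-ecol≡incident (fsuc i) j =
      cong₂ _∷_ (ecol-Step (up (fsuc i) j)) (cong₂ _∷_ (ecol-Step (down (fsuc i) j))
        (cong₂ _∷_ (ecol-Step (inward i j)) (cong₂ _∷_ (ecol-Step (right i j))
          (cong₂ _∷_ (ecol-Step (left i j)) refl))))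

    weightAt : Fin (suc m) → Fin n → ℕ
    weightAt a j = vertex a j + sum (incident a j)

    weight-⟨⟩ : ∀ a j → weight G colouring ⟨ a , j ⟩ ≡ weightAt a j
    weight-⟨⟩ a j = trans (weight-neighbourhood G ⟨ a , j ⟩ colouring (neighbourhood a j))
      (cong₂ _+_ (vcol-⟨⟩ a j) (cong sum (map-ecol≡incident a j)))

    ecol∈incident : ∀ {a j y} → Step a j y → ecol colouring ⟨ a , j ⟩ y ∈ incident a j
    ecol∈incident {a} {j} {y} s =
      subst (ecol colouring ⟨ a , j ⟩ y ∈_) (map-ecol≡incident a j) (∈-map⁺ _ (Step⇒∈ s))

    record Valid (k : ℕ) : Set where
      field
        vertex-range       : ∀ a j → InRange k (vertex a j)
        incident-range     : ∀ a j → All (InRange k) (incident a j)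
        distinct           : ∀ a j → Unique (vertex a j ∷ incident a j)
        vertices-separated : Separates vertex
        weights-separated  : Separates weightAt

    Valid⇒HasNSDTC : ∀ {k} → Valid k → HasNSDTC G k
    Valid⇒HasNSDTC {k} valid =
      colouring , (vcol-range , ecol-range , ecol-sym , vcol-distinct , ecol≢ends , ecol-distinct) , weight-distinct
      where
      open Valid valid

      vcol-range : ∀ x → InRange k (vcol colouring x)
      vcol-range x with coordinates x
      ... | a , j , refl = subst (InRange k) (sym (vcol-⟨⟩ a j)) (vertex-range a j)

      ecol-range : ∀ x y → Adj G x y → InRange k (ecol colouring x y)
      ecol-range x y h with Adj⇒Edge {x} {y} h
      ... | along {a} {j} s = All.lookup (incident-range a j) (ecol∈incident s)

      ecol-sym : ∀ x y → Adj G x y → ecol colouring x y ≡ ecol colouring y x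
      ecol-sym x y h with Adj⇒Edge {x} {y} h
      ... | along s = trans (ecol-Step s) (sym (ecol-Step⁻¹ s))

      vcol-distinct : ∀ x y → Adj G x y → vcol colouring x ≢ vcol colouring y
      vcol-distinct x y = separated vertices-separated (vcol colouring) vcol-⟨⟩ {x} {y}

      ecol≢tail : ∀ x y → Adj G x y → ecol colouring x y ≢ vcol colouring x
      ecol≢tail x y h with Adj⇒Edge {x} {y} h
      ... | along {a} {j} s with distinct a j
      ...   | vertex∉ ∷ _ = λ e → All.lookup vertex∉ (ecol∈incident s) (sym (trans e (vcol-⟨⟩ a j)))

      ecol≢ends : ∀ x y → Adj G x y → ecol colouring x y ≢ vcol colouring x × ecol colouring x y ≢ vcol colouring y
      ecol≢ends x y h = ecol≢tail x y h , λ e → ecol≢tail y x (Adj-sym {x} {y} h) (trans (sym (ecol-sym x y h)) e)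

      ecol-distinct : ∀ x y w → Adj G x y → Adj G x w → y ≢ w → ecol colouring x y ≢ ecol colouring x w
      ecol-distinct x y w hy hw y≢w with Adj⇒Edge {x} {y} hy
      ... | along {a} {j} s with distinct a j
      ...   | _ ∷ u = map-unique⇒≢ (ecol colouring ⟨ a , j ⟩) (subst Unique (sym (map-ecol≡incident a j)) u)
                        (Step⇒∈ s) (complete (neighbourhood a j) hw) y≢w

      weight-distinct : DistinguishesBySums G colouring
      weight-distinct x y = separated weights-separated (weight G colouring) weight-⟨⟩ {x} {y}

  -- Colourings in which row j only depends on the classes of j - 1 and j

  record Pattern : Set where
    field
      vertex   : Class → Class → Fin (suc m) → ℕ
      spoke    : Class → Class → Fin m → ℕ
      rim      : Class → Class → Fin m → ℕ
      vertical : Fin (suc m) → Class → ℕ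

  module _ (P : Pattern) where
    open Pattern P

    scheme : Scheme
    scheme = record
      { vertex   = λ a j → vertex (class (prev j)) (class j) a
      ; spoke    = λ i j → spoke (class (prev j)) (class j) i
      ; rim      = λ i j → rim (class (prev j)) (class j) i
      ; vertical = λ a j → vertical a (class j)
      }

    incidentAt : Class → Class → Fin (suc m) → List ℕ
    incidentAt q r fzero    = vertical fzero r ∷ vertical fzero q ∷ map (spoke q r) (allFin m)
    incidentAt q r (fsuc i) =
      vertical (fsuc i) r ∷ vertical (fsuc i) q ∷ spoke q r i ∷ rim q r i ∷ rim q r (prev i) ∷ []

    weightOf : Class → Class → Fin (suc m) → ℕ
    weightOf q r a = vertex q r a + sum (incidentAt q r a)

    record WindowValid (k : ℕ) (q r s : Class) : Set where
      constructor windowValid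
      field
        vertex-range   : ∀ a → InRange k (vertex q r a)
        incident-range : ∀ a → All (InRange k) (incidentAt q r a)
        distinct       : ∀ a → Unique (vertex q r a ∷ incidentAt q r a)
        vertex-spoke   : ∀ i → vertex q r fzero ≢ vertex q r (fsuc i)
        vertex-rim     : ∀ i → vertex q r (fsuc i) ≢ vertex q r (fsuc (next i))
        vertex-cycle   : ∀ a → vertex q r a ≢ vertex r s a
        weight-spoke   : ∀ i → weightOf q r fzero ≢ weightOf q r (fsuc i)
        weight-rim     : ∀ i → weightOf q r (fsuc i) ≢ weightOf q r (fsuc (next i))
        weight-cycle   : ∀ a → weightOf q r a ≢ weightOf r s a

    PatternValid : ℕ → Set
    PatternValid k = ∀ {q r s} → Window q r s → WindowValid k q r s

    incident≡ : ∀ a j → incident scheme a j ≡ incidentAt (class (prev j)) (class j) a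
    incident≡ fzero    j = refl
    incident≡ (fsuc i) j = refl

    weightAt≡ : ∀ a j → weightAt scheme a j ≡ weightOf (class (prev j)) (class j) a
    weightAt≡ a j = cong (λ l → vertex (class (prev j)) (class j) a + sum l) (incident≡ a j)

    PatternValid⇒Valid : ∀ {k} → PatternValid k → Valid scheme k
    PatternValid⇒Valid {k} valid = record
      { vertex-range       = λ a j → vertex-range (at j) a
      ; incident-range     = λ a j → subst (All (InRange k)) (sym (incident≡ a j)) (incident-range (at j) a)
      ; distinct           = λ a j → subst (Unique ∘ (_ ∷_)) (sym (incident≡ a j)) (distinct (at j) a)
      ; vertices-separated = record
        { across-spoke = λ i j → vertex-spoke (at j) i
        ; across-rim   = λ i j → vertex-rim (at j) i
        ; across-cycle = λ a j e → vertex-cycle (at j) a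
                                     (trans e (cong (λ z → vertex (class z) (class (next j)) a) (prev-next j)))
        }
      ; weights-separated = record
        { across-spoke = λ i j e → weight-spoke (at j) i
                                     (trans (sym (weightAt≡ fzero j)) (trans e (weightAt≡ (fsuc i) j)))
        ; across-rim   = λ i j e → weight-rim (at j) i
                                     (trans (sym (weightAt≡ (fsuc i) j)) (trans e (weightAt≡ (fsuc (next i)) j)))
        ; across-cycle = λ a j e → weight-cycle (at j) a (trans (sym (weightAt≡ a j)) (trans e
                                     (trans (weightAt≡ a (next j))
                                            (cong (λ z → weightOf (class z) (class (next j)) a) (prev-next j)))))
        }
      }
      where
      open WindowValid
      at : ∀ j → WindowValid k (class (prev j)) (class j) (class (next j))
      at j = valid (window j)

    windowValid? : ∀ k q r s → Dec (WindowValid k q r s)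
    windowValid? k q r s = map′
      (λ (a , b , c , d , e , f , g , h , i) → windowValid a b c d e f g h i)
      (λ w → let open WindowValid w in
        vertex-range , incident-range , distinct , vertex-spoke , vertex-rim , vertex-cycle ,
        weight-spoke , weight-rim , weight-cycle)
      ( Fin.all? (λ a → InRange? k (vertex q r a))
      ×-dec Fin.all? (λ a → All.all? (InRange? k) (incidentAt q r a))
      ×-dec Fin.all? (λ a → allPairs? ≢? (vertex q r a ∷ incidentAt q r a))
      ×-dec Fin.all? (λ i → ≢? (vertex q r fzero) (vertex q r (fsuc i)))
      ×-dec Fin.all? (λ i → ≢? (vertex q r (fsuc i)) (vertex q r (fsuc (next i))))
      ×-dec Fin.all? (λ a → ≢? (vertex q r a) (vertex r s a))
      ×-dec Fin.all? (λ i → ≢? (weightOf q r fzero) (weightOf q r (fsuc i)))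
      ×-dec Fin.all? (λ i → ≢? (weightOf q r (fsuc i)) (weightOf q r (fsuc (next i))))
      ×-dec Fin.all? (λ a → ≢? (weightOf q r a) (weightOf r s a)))

    AllWindowsValid : ℕ → Set
    AllWindowsValid k =
      WindowValid k even odd even × WindowValid k odd even odd × WindowValid k even odd last ×
      WindowValid k odd even last × WindowValid k last even odd × WindowValid k even last even ×
      WindowValid k odd last even

    allWindowsValid? : ∀ k → Dec (AllWindowsValid k)
    allWindowsValid? k =
      windowValid? k even odd even ×-dec windowValid? k odd even odd ×-dec windowValid? k even odd last ×-dec
      windowValid? k odd even last ×-dec windowValid? k last even odd ×-dec windowValid? k even last even ×-dec
      windowValid? k odd last even

    AllWindowsValid⇒PatternValid : ∀ {k} → AllWindowsValid k → PatternValid k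
    AllWindowsValid⇒PatternValid (w , _ , _ , _ , _ , _ , _) even-odd-even  = w
    AllWindowsValid⇒PatternValid (_ , w , _ , _ , _ , _ , _) odd-even-odd   = w
    AllWindowsValid⇒PatternValid (_ , _ , w , _ , _ , _ , _) even-odd-last  = w
    AllWindowsValid⇒PatternValid (_ , _ , _ , w , _ , _ , _) odd-even-last  = w
    AllWindowsValid⇒PatternValid (_ , _ , _ , _ , w , _ , _) last-even-odd  = w
    AllWindowsValid⇒PatternValid (_ , _ , _ , _ , _ , w , _) even-last-even = w
    AllWindowsValid⇒PatternValid (_ , _ , _ , _ , _ , _ , w) odd-last-even  = w

  PatternValid⇒HasNSDTC : ∀ (P : Pattern) {k} → PatternValid P k → HasNSDTC G k
  PatternValid⇒HasNSDTC P = Valid⇒HasNSDTC (scheme P) ∘ PatternValid⇒Valid P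

  fromTables : Tables m → Pattern
  fromTables T = record
    { vertex   = λ q r → Vec.lookup (vertexTable q r)
    ; spoke    = λ q r → Vec.lookup (spokeTable q r)
    ; rim      = λ q r → Vec.lookup (rimTable q r)
    ; vertical = λ _ → verticalTable
    }
    where open Tables T

  tables⇒HasNSDTC : (T : Tables m) → AllWindowsValid (fromTables T) (m + 4) → HasNSDTC G (m + 4)
  tables⇒HasNSDTC T = PatternValid⇒HasNSDTC (fromTables T) ∘ AllWindowsValid⇒PatternValid (fromTables T)

module General (m₁ n₀ : ℕ) where
  open WheelCycle (3 + m₁) n₀

  large : Fin m → ℕ
  large i = 5 + toℕ i

  large-injective : ∀ {i j} → large i ≡ large j → i ≡ j
  large-injective e = Fin.toℕ-injective (ℕ.+-cancelˡ-≡ 5 _ _ e)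

  large-range : ∀ i → InRange (m + 4) (large i)
  large-range i = s≤s z≤n , subst (_≤ m + 4) (ℕ.+-comm (suc (toℕ i)) 4) (ℕ.+-monoˡ-≤ 4 (Fin.toℕ<n i))

  small≢large : ∀ {c} i → c ≤ 4 → c ≢ large i
  small≢large i c≤4 e = ℕ.<-irrefl e (s≤s (ℕ.≤-trans c≤4 (ℕ.m≤m+n 4 (toℕ i))))

  small-range : ∀ {c} → InRange 4 c → InRange (m + 4) c
  small-range (1≤c , c≤4) = 1≤c , ℕ.≤-trans c≤4 (ℕ.m≤n+m 4 m)

  tiny-range : ∀ {c} → InRange 3 c → InRange (m + 4) c
  tiny-range (1≤c , c≤3) = small-range (1≤c , ℕ.≤-trans c≤3 (ℕ.n≤1+n 3))

  vertexShift : Class → ℕ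
  vertexShift even = 2
  vertexShift odd  = 3
  vertexShift last = 1

  rimVertical : Class → ℕ
  rimVertical even = 3
  rimVertical odd  = 2
  rimVertical last = 1

  hubVertical : Class → ℕ
  hubVertical even = 1
  hubVertical odd  = 2
  hubVertical last = 3

  hubColour : Class → Class → ℕ
  hubColour _    even = 4
  hubColour _    odd  = 3
  hubColour odd  last = 1
  hubColour _    last = 2

  spokeColour : Class → Fin m → ℕ
  spokeColour last fzero = 4
  spokeColour _    i     = large i

  -- how far the spoke colour falls short of large i
  defect : Class → Fin m → ℕ
  defect last fzero = 1
  defect _    _     = 0

  vertexColour : Class → Class → Fin (suc m) → ℕ
  vertexColour q r fzero    = hubColour q r
  vertexColour q r (fsuc i) = large (shift (vertexShift r) i)

  verticalColour : Fin (suc m) → Class → ℕ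
  verticalColour fzero    = hubVertical
  verticalColour (fsuc _) = rimVertical

  generalPattern : Pattern
  generalPattern = record
    { vertex   = vertexColour
    ; spoke    = λ _ → spokeColour
    ; rim      = λ _ _ i → large (prev i)
    ; vertical = verticalColour
    }

  -- The large colours around rim vertex i + 1 (taking the spoke defect into account) are large p for
  -- these positions p; with one extra position they are shifts of prev (prev i) by distinct offsets.
  rimPositions : Class → Fin m → List (Fin m)
  rimPositions r i = shift (vertexShift r) i ∷ i ∷ prev i ∷ prev (prev i) ∷ []

  extraOffset : Class → ℕ
  extraOffset even = 3
  extraOffset odd  = 3
  extraOffset last = 4

  offsets : Class → List ℕ
  offsets r = extraOffset r ∷ vertexShift r + 2 ∷ 2 ∷ 1 ∷ 0 ∷ []

  unique-offsets : ∀ r → Unique (offsets r)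
  unique-offsets even = from-yes (unique? (offsets even))
  unique-offsets odd  = from-yes (unique? (offsets odd))
  unique-offsets last = from-yes (unique? (offsets last))

  offsets<m : ∀ r → All (_< m) (offsets r)
  offsets<m r = All.map (λ d<6 → ℕ.<-≤-trans d<6 (ℕ.m≤m+n 6 m₁)) (offsets<6 r)
    where
    offsets<6 : ∀ r → All (_< 6) (offsets r)
    offsets<6 even = from-yes (All.all? (ℕ._<? 6) (offsets even))
    offsets<6 odd  = from-yes (All.all? (ℕ._<? 6) (offsets odd))
    offsets<6 last = from-yes (All.all? (ℕ._<? 6) (offsets last))

  shifts-of-prev² : ∀ r i →
    map (λ d → shift d (prev (prev i))) (offsets r) ≡ shift (extraOffset r) (prev (prev i)) ∷ rimPositions r i
  shifts-of-prev² r i = cong (shift (extraOffset r) (prev (prev i)) ∷_)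
    (cong₂ _∷_ (sym shift-t) (cong₂ _∷_ two (cong₂ _∷_ one refl)))
    where
    u = prev (prev i)
    one : shift 1 u ≡ prev i
    one = next-prev (prev i)
    two : shift 2 u ≡ i
    two = trans (cong next one) (next-prev i)
    shift-t : shift (vertexShift r) i ≡ shift (vertexShift r + 2) u
    shift-t = trans (cong (shift (vertexShift r)) (sym two)) (shift-+ (vertexShift r) 2 u)

  unique-positions : ∀ r i → Unique (shift (extraOffset r) (prev (prev i)) ∷ rimPositions r i)
  unique-positions r i = subst Unique (shifts-of-prev² r i)
    (Unique-map⁺ (λ d → shift d (prev (prev i))) (unique-offsets r) λ d∈ e∈ d≢e →
      d≢e ∘ shift-injectiveˡ _ _ (prev (prev i)) (All.lookup (offsets<m r) d∈) (All.lookup (offsets<m r) e∈))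

  unique-rimPositions : ∀ r i → Unique (rimPositions r i)
  unique-rimPositions r i with unique-positions r i
  ... | _ ∷ u = u

  rimPositions-next : ∀ r i → rimPositions r (next i) ≡ map next (rimPositions r i)
  rimPositions-next r i = cong₂ _∷_ (shift-next (vertexShift r) i) (cong (next i ∷_) (cong₂ _∷_
    (trans (prev-next i) (sym (next-prev i)))
    (cong (_∷ []) (trans (cong prev (prev-next i)) (sym (next-prev (prev i)))))))

  rimVertical-range : ∀ r → InRange 3 (rimVertical r)
  rimVertical-range even = s≤s z≤n , ℕ.≤-refl
  rimVertical-range odd  = s≤s z≤n , s≤s (s≤s z≤n)
  rimVertical-range last = s≤s z≤n , s≤s z≤n

  hubVertical-range : ∀ r → InRange 3 (hubVertical r)
  hubVertical-range even = s≤s z≤n , s≤s z≤n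
  hubVertical-range odd  = s≤s z≤n , s≤s (s≤s z≤n)
  hubVertical-range last = s≤s z≤n , ℕ.≤-refl

  hubColour-range : ∀ q r → InRange 4 (hubColour q r)
  hubColour-range q    even = s≤s z≤n , ℕ.≤-refl
  hubColour-range q    odd  = s≤s z≤n , ℕ.n≤1+n 3
  hubColour-range even last = s≤s z≤n , s≤s (s≤s z≤n)
  hubColour-range odd  last = s≤s z≤n , s≤s z≤n
  hubColour-range last last = s≤s z≤n , s≤s (s≤s z≤n)

  rimVertical≤3 : ∀ r → rimVertical r ≤ 3
  rimVertical≤3 = proj₂ ∘ rimVertical-range

  hubVertical≤3 : ∀ r → hubVertical r ≤ 3
  hubVertical≤3 = proj₂ ∘ hubVertical-range

  hubColour≤4 : ∀ q r → hubColour q r ≤ 4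
  hubColour≤4 q = proj₂ ∘ hubColour-range q

  ≤3⇒≤4 : ∀ {c} → c ≤ 3 → c ≤ 4
  ≤3⇒≤4 c≤3 = ℕ.≤-trans c≤3 (ℕ.n≤1+n 3)

  spoke≢large : ∀ r {i z} → i ≢ z → spokeColour r i ≢ large z
  spoke≢large even     i≢z = i≢z ∘ large-injective
  spoke≢large odd      i≢z = i≢z ∘ large-injective
  spoke≢large last {fzero}  {z} _ = small≢large z ℕ.≤-refl
  spoke≢large last {fsuc _} i≢z = i≢z ∘ large-injective

  small≢spoke : ∀ {c} r i → c ≤ 3 → c ≢ spokeColour r i
  small≢spoke even i        c≤3 = small≢large i (≤3⇒≤4 c≤3)
  small≢spoke odd  i        c≤3 = small≢large i (≤3⇒≤4 c≤3)
  small≢spoke last fzero    c≤3 = λ c≡4 → ℕ.<-irrefl c≡4 (s≤s c≤3)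
  small≢spoke last (fsuc i) c≤3 = small≢large (fsuc i) (≤3⇒≤4 c≤3)

  hubColour≢spoke : ∀ q r i → hubColour q r ≢ spokeColour r i
  hubColour≢spoke q    even i        = small≢large i (hubColour≤4 q even)
  hubColour≢spoke q    odd  i        = small≢large i (hubColour≤4 q odd)
  hubColour≢spoke even last fzero    = λ ()
  hubColour≢spoke odd  last fzero    = λ ()
  hubColour≢spoke last last fzero    = λ ()
  hubColour≢spoke q    last (fsuc i) = small≢large (fsuc i) (hubColour≤4 q last)

  spokeColour-injective : ∀ r {i z} → spokeColour r i ≡ spokeColour r z → i ≡ z
  spokeColour-injective even e = large-injective e
  spokeColour-injective odd  e = large-injective e
  spokeColour-injective last {fzero}  {fzero}  _ = refl
  spokeColour-injective last {fzero}  {fsuc z} e = ⊥-elim (small≢large (fsuc z) ℕ.≤-refl e)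
  spokeColour-injective last {fsuc i} {fzero}  e = ⊥-elim (small≢large (fsuc i) ℕ.≤-refl (sym e))
  spokeColour-injective last {fsuc i} {fsuc z} e = large-injective e

  rim-distinct : ∀ q r i → rimVertical r ≢ rimVertical q →
    Unique (vertexColour q r (fsuc i) ∷ incidentAt generalPattern q r (fsuc i))
  rim-distinct q r i r≢q with unique-rimPositions r i
  ... | (y≢i ∷ y≢p ∷ y≢pp ∷ []) ∷ (i≢p ∷ i≢pp ∷ []) ∷ (p≢pp ∷ []) ∷ [] ∷ [] =
      ( large≢small (rimVertical≤3 r) ∷ large≢small (rimVertical≤3 q) ∷ (spoke≢large r (y≢i ∘ sym) ∘ sym)
      ∷ (y≢p ∘ large-injective) ∷ (y≢pp ∘ large-injective) ∷ [])
    ∷ (r≢q ∷ small≢spoke r i (rimVertical≤3 r)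
      ∷ small≢large (prev i) (≤3⇒≤4 (rimVertical≤3 r))
      ∷ small≢large (prev (prev i)) (≤3⇒≤4 (rimVertical≤3 r)) ∷ [])
    ∷ (small≢spoke r i (rimVertical≤3 q)
      ∷ small≢large (prev i) (≤3⇒≤4 (rimVertical≤3 q))
      ∷ small≢large (prev (prev i)) (≤3⇒≤4 (rimVertical≤3 q)) ∷ [])
    ∷ (spoke≢large r i≢p ∷ spoke≢large r i≢pp ∷ [])
    ∷ ((p≢pp ∘ large-injective) ∷ [])
    ∷ [] ∷ []
    where
    large≢small : ∀ {c} → c ≤ 3 → large (shift (vertexShift r) i) ≢ c
    large≢small c≤3 = small≢large _ (≤3⇒≤4 c≤3) ∘ sym

  hub-distinct : ∀ q r → hubColour q r ≢ hubVertical r → hubColour q r ≢ hubVertical q →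
    hubVertical r ≢ hubVertical q → Unique (vertexColour q r fzero ∷ incidentAt generalPattern q r fzero)
  hub-distinct q r c≢r c≢q r≢q =
      (c≢r ∷ c≢q ∷ all-spokes (hubColour≢spoke q r))
    ∷ (r≢q ∷ all-spokes (λ i → small≢spoke r i (hubVertical≤3 r)))
    ∷ all-spokes (λ i → small≢spoke r i (hubVertical≤3 q))
    ∷ Unique.map⁺ (spokeColour-injective r) (Unique.allFin⁺ m)
    where
    all-spokes : ∀ {P : ℕ → Set} → (∀ i → P (spokeColour r i)) → All P (map (spokeColour r) (allFin m))
    all-spokes p = All.map⁺ (All.tabulate λ {i} _ → p i)

  generalWeight : Class → Class → Fin (suc m) → ℕ
  generalWeight = weightOf generalPattern

  spoke+defect : ∀ r i → spokeColour r i + defect r i ≡ large i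
  spoke+defect even i        = ℕ.+-identityʳ _
  spoke+defect odd  i        = ℕ.+-identityʳ _
  spoke+defect last fzero    = refl
  spoke+defect last (fsuc i) = ℕ.+-identityʳ _

  defect≤1 : ∀ r i → defect r i ≤ 1
  defect≤1 even i        = z≤n
  defect≤1 odd  i        = z≤n
  defect≤1 last fzero    = ℕ.≤-refl
  defect≤1 last (fsuc i) = z≤n

  rim-weight : ∀ q r i →
    generalWeight q r (fsuc i) + defect r i ≡ sum (map toℕ (rimPositions r i)) + (20 + (rimVertical r + rimVertical q))
  rim-weight q r i = begin
    5 + y + (a + (b + (s + (5 + p + (5 + u + 0))))) + d ≡⟨ regroup y a b s p u d ⟩
    s + d + (y + (p + u)) + (15 + (a + b))
      ≡⟨ cong (λ z → z + (y + (p + u)) + (15 + (a + b))) (spoke+defect r i) ⟩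
    5 + x + (y + (p + u)) + (15 + (a + b))             ≡⟨ regroup′ y a b x p u ⟩
    y + (x + (p + (u + 0))) + (20 + (a + b))           ∎
    where
    open ≡-Reasoning
    y = toℕ (shift (vertexShift r) i)
    x = toℕ i
    p = toℕ (prev i)
    u = toℕ (prev (prev i))
    a = rimVertical r
    b = rimVertical q
    s = spokeColour r i
    d = defect r i
    regroup : ∀ y a b s p u d →
      5 + y + (a + (b + (s + (5 + p + (5 + u + 0))))) + d ≡ s + d + (y + (p + u)) + (15 + (a + b))
    regroup = solve-∀
    regroup′ : ∀ y a b x p u → 5 + x + (y + (p + u)) + (15 + (a + b)) ≡ y + (x + (p + (u + 0))) + (20 + (a + b))
    regroup′ = solve-∀

  -- Moving along the rim raises the sum of the four positions by 4, or by 4 - m if one of them wraps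
  -- around; the defects, which are at most 1, cannot make up for either.
  rim-weight-rim : ∀ q r i → generalWeight q r (fsuc i) ≢ generalWeight q r (fsuc (next i))
  rim-weight-rim q r i eq =
    [ no-wraparound , wraparound ∘ proj₁ ]′ (sum-toℕ-next (rimPositions r i) (unique-rimPositions r i))
    where
    open ≡-Reasoning
    X  = 20 + (rimVertical r + rimVertical q)
    S  = sum (map toℕ (rimPositions r i))
    S′ = sum (map (toℕ ∘ next) (rimPositions r i))
    δ  = defect r i
    δ′ = defect r (next i)
    balance : S + δ′ ≡ S′ + δ
    balance = cancel-weights (rim-weight q r i)
      (trans (rim-weight q r (next i)) (cong (λ ps → sum ps + X)
        (trans (cong (map toℕ) (rimPositions-next r i))
               (sym (List.map-∘ {g = toℕ} {f = next} (rimPositions r i))))))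
      eq
    no-wraparound : S′ ≡ S + 4 → ⊥
    no-wraparound S′≡
      with subst (_≤ 1) (ℕ.+-cancelˡ-≡ S δ′ (4 + δ) (trans balance (trans (cong (_+ δ) S′≡) (ℕ.+-assoc S 4 δ))))
                 (defect≤1 r (next i))
    ... | s≤s ()
    wraparound : S′ + m ≡ S + 4 → ⊥
    wraparound S′+m≡ = ℕ.<-irrefl refl (ℕ.≤-trans (ℕ.m≤m+n 6 m₁) (ℕ.≤-trans (ℕ.m≤n+m m δ′)
      (ℕ.≤-trans (ℕ.≤-reflexive δ′+m≡) (ℕ.+-monoʳ-≤ 4 (defect≤1 r i)))))
      where
      δ′+m≡ : δ′ + m ≡ 4 + δ
      δ′+m≡ = ℕ.+-cancelˡ-≡ S _ _ (begin
        S + (δ′ + m) ≡⟨ ℕ.+-assoc S δ′ m ⟨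
        S + δ′ + m   ≡⟨ cong (_+ m) balance ⟩
        S′ + δ + m   ≡⟨ swap S′ δ m ⟩
        S′ + m + δ   ≡⟨ cong (_+ δ) S′+m≡ ⟩
        S + 4 + δ    ≡⟨ ℕ.+-assoc S 4 δ ⟩
        S + (4 + δ)  ∎)

  rim-cycle-balance : ∀ q r s i → generalWeight q r (fsuc i) ≡ generalWeight r s (fsuc i) →
    toℕ (shift (vertexShift r) i) + (rimVertical q + defect s i) ≡
    toℕ (shift (vertexShift s) i) + (rimVertical s + defect r i)
  rim-cycle-balance q r s i eq = ℕ.+-cancelʳ-≡ (R + (20 + rimVertical r)) _ _ (begin
    yr + (b + ds) + (R + (20 + a))         ≡⟨ regroup yr b ds R a ⟩
    yr + R + (20 + (a + b)) + ds           ≡⟨ cong (_+ ds) (rim-weight q r i) ⟨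
    generalWeight q r (fsuc i) + dr + ds       ≡⟨ swap (generalWeight q r (fsuc i)) dr ds ⟩
    generalWeight q r (fsuc i) + ds + dr       ≡⟨ cong (λ w → w + ds + dr) eq ⟩
    generalWeight r s (fsuc i) + ds + dr       ≡⟨ cong (_+ dr) (rim-weight r s i) ⟩
    ys + R + (20 + (c + a)) + dr           ≡⟨ regroup′ ys c dr R a ⟨
    ys + (c + dr) + (R + (20 + a))         ∎)
    where
    open ≡-Reasoning
    yr = toℕ (shift (vertexShift r) i)
    ys = toℕ (shift (vertexShift s) i)
    R  = toℕ i + (toℕ (prev i) + (toℕ (prev (prev i)) + 0))
    a  = rimVertical r
    b  = rimVertical q
    c  = rimVertical s
    dr = defect r i
    ds = defect s i
    regroup : ∀ y b d R a → y + (b + d) + (R + (20 + a)) ≡ y + R + (20 + (a + b)) + d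
    regroup = solve-∀
    regroup′ : ∀ y c d R a → y + (c + d) + (R + (20 + a)) ≡ y + R + (20 + (c + a)) + d
    regroup′ = solve-∀

  shift-gap : ∀ t d i {c c′} → d ≤ 2 → toℕ (shift t i) + c ≡ toℕ (shift (d + t) i) + c′ →
              c ≡ d + c′ ⊎ c + m ≡ d + c′
  shift-gap t d i {c} {c′} d≤2 eq with toℕ-shift d (shift t i) (ℕ.≤-trans (s≤s d≤2) (ℕ.m≤m+n 3 _))
  ... | inj₁ z≡ = inj₁ (ℕ.+-cancelˡ-≡ x _ _ (begin
    x + c        ≡⟨ eq ⟩
    z + c′       ≡⟨ cong (_+ c′) (trans (cong toℕ (sym (shift-+ d t i))) z≡) ⟩
    x + d + c′   ≡⟨ ℕ.+-assoc x d c′ ⟩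
    x + (d + c′) ∎))
    where
    open ≡-Reasoning
    x = toℕ (shift t i)
    z = toℕ (shift (d + t) i)
  ... | inj₂ z+m≡ = inj₂ (ℕ.+-cancelˡ-≡ x _ _ (begin
    x + (c + m)  ≡⟨ ℕ.+-assoc x c m ⟨
    x + c + m    ≡⟨ cong (_+ m) eq ⟩
    z + c′ + m   ≡⟨ swap z c′ m ⟩
    z + m + c′   ≡⟨ cong (λ w → toℕ w + m + c′) (shift-+ d t i) ⟨
    toℕ (shift d (shift t i)) + m + c′ ≡⟨ cong (_+ c′) z+m≡ ⟩
    x + d + c′   ≡⟨ ℕ.+-assoc x d c′ ⟩
    x + (d + c′) ∎))
    where
    open ≡-Reasoning
    x = toℕ (shift t i)
    z = toℕ (shift (d + t) i)

  rim-weight-cycle : ∀ {q r s} → Window q r s → ∀ i → generalWeight q r (fsuc i) ≢ generalWeight r s (fsuc i)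
  rim-weight-cycle {q} {r} {s} w i eq = by-window w i (rim-cycle-balance q r s i eq)
    where
    1≤2 : 1 ≤ 2
    1≤2 = s≤s z≤n
    by-window : ∀ {q r s} → Window q r s → ∀ i →
      toℕ (shift (vertexShift r) i) + (rimVertical q + defect s i) ≡
      toℕ (shift (vertexShift s) i) + (rimVertical s + defect r i) → ⊥
    by-window even-odd-even  i        h = [ (λ ()) , (λ ()) ]′ (shift-gap 2 1 i 1≤2 (sym h))
    by-window odd-even-odd   i        h = [ (λ ()) , (λ ()) ]′ (shift-gap 2 1 i 1≤2 h)
    by-window even-odd-last  fzero    h = [ (λ ()) , (λ ()) ]′ (shift-gap 1 2 fzero ℕ.≤-refl (sym h))
    by-window even-odd-last  (fsuc i) h = [ (λ ()) , (λ ()) ]′ (shift-gap 1 2 (fsuc i) ℕ.≤-refl (sym h))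
    by-window odd-even-last  fzero    h = [ (λ ()) , (λ ()) ]′ (shift-gap 1 1 fzero 1≤2 (sym h))
    by-window odd-even-last  (fsuc i) h = [ (λ ()) , (λ ()) ]′ (shift-gap 1 1 (fsuc i) 1≤2 (sym h))
    by-window last-even-odd  i        h = [ (λ ()) , (λ ()) ]′ (shift-gap 2 1 i 1≤2 h)
    by-window even-last-even fzero    h = [ (λ ()) , (λ ()) ]′ (shift-gap 1 1 fzero 1≤2 h)
    by-window even-last-even (fsuc i) h = [ (λ ()) , (λ ()) ]′ (shift-gap 1 1 (fsuc i) 1≤2 h)
    by-window odd-last-even  fzero    h = [ (λ ()) , (λ ()) ]′ (shift-gap 1 1 fzero 1≤2 h)
    by-window odd-last-even  (fsuc i) h = [ (λ ()) , (λ ()) ]′ (shift-gap 1 1 (fsuc i) 1≤2 h)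

  largeTotal : ℕ
  largeTotal = sum (map large (allFin m))

  sum-spokes : ∀ r → sum (map (spokeColour r) (allFin m)) + defect r fzero ≡ largeTotal
  sum-spokes even = ℕ.+-identityʳ _
  sum-spokes odd  = ℕ.+-identityʳ _
  sum-spokes last = trans (ℕ.+-comm (4 + sum (map (spokeColour last) (List.tabulate fsuc))) 1)
    (cong (λ l → 5 + sum l)
      (trans (List.map-tabulate fsuc (spokeColour last)) (sym (List.map-tabulate fsuc large))))

  hubSmall : Class → Class → ℕ
  hubSmall q r = hubColour q r + (hubVertical r + hubVertical q)

  hub-weight : ∀ q r → generalWeight q r fzero + defect r fzero ≡ hubSmall q r + largeTotal
  hub-weight q r = trans (regroup (hubColour q r) (hubVertical r) (hubVertical q) _ (defect r fzero))
    (cong (hubSmall q r +_) (sum-spokes r))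
    where
    regroup : ∀ c a b s d → c + (a + (b + s)) + d ≡ c + (a + b) + (s + d)
    regroup = solve-∀

  record WindowFacts (q r s : Class) : Set where
    constructor windowFacts
    field
      rimVerticals≢  : rimVertical r ≢ rimVertical q
      shifts≢        : vertexShift r ≢ vertexShift s
      hubColours≢    : hubColour q r ≢ hubColour r s
      hubColour≢up   : hubColour q r ≢ hubVertical r
      hubColour≢down : hubColour q r ≢ hubVertical q
      hubVerticals≢  : hubVertical r ≢ hubVertical q
      hubSmall≥6     : 6 ≤ hubSmall q r
      hub-unbalanced : hubSmall q r + defect s fzero ≢ hubSmall r s + defect r fzero

  windowFacts? : ∀ q r s → Dec (WindowFacts q r s)
  windowFacts? q r s = map′
    (λ (a , b , c , d , e , f , g , h) → windowFacts a b c d e f g h)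
    (λ w → let open WindowFacts w in
      rimVerticals≢ , shifts≢ , hubColours≢ , hubColour≢up , hubColour≢down , hubVerticals≢ ,
      hubSmall≥6 , hub-unbalanced)
    (  ≢? (rimVertical r) (rimVertical q)
    ×-dec ≢? (vertexShift r) (vertexShift s)
    ×-dec ≢? (hubColour q r) (hubColour r s)
    ×-dec ≢? (hubColour q r) (hubVertical r)
    ×-dec ≢? (hubColour q r) (hubVertical q)
    ×-dec ≢? (hubVertical r) (hubVertical q)
    ×-dec 6 ℕ.≤? hubSmall q r
    ×-dec ≢? (hubSmall q r + defect s fzero) (hubSmall r s + defect r fzero))

  facts : ∀ {q r s} → Window q r s → WindowFacts q r s
  facts even-odd-even  = from-yes (windowFacts? even odd even)
  facts odd-even-odd   = from-yes (windowFacts? odd even odd)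
  facts even-odd-last  = from-yes (windowFacts? even odd last)
  facts odd-even-last  = from-yes (windowFacts? odd even last)
  facts last-even-odd  = from-yes (windowFacts? last even odd)
  facts even-last-even = from-yes (windowFacts? even last even)
  facts odd-last-even  = from-yes (windowFacts? odd last even)

  hub-weight-cycle : ∀ {q r s} → Window q r s → generalWeight q r fzero ≢ generalWeight r s fzero
  hub-weight-cycle {q} {r} {s} w eq =
    WindowFacts.hub-unbalanced (facts w) (cancel-weights (hub-weight q r) (hub-weight r s) eq)

  -- The spokes at a hub carry all the large colours, so already five of them exceed what the rim
  -- vertex can collect.
  hub-weight-spoke : ∀ {q r s} → Window q r s → ∀ i → generalWeight q r fzero ≢ generalWeight q r (fsuc i)
  hub-weight-spoke {q} {r} w i eq = ℕ.<-irrefl refl (begin-strict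
    S + 27
      <⟨ ℕ.+-monoʳ-< S (from-yes (27 ℕ.<? 31)) ⟩
    S + 31
      ≡⟨ regroup S ⟩
    25 + S + 6
      ≤⟨ ℕ.+-mono-≤ (ℕ.+-monoʳ-≤ 25 (ℕ.m≤n+m S (toℕ e))) (WindowFacts.hubSmall≥6 (facts w)) ⟩
    25 + (toℕ e + S) + hubSmall q r
      ≡⟨ cong (_+ hubSmall q r) (sum-large (toℕ e) _ _ _ _) ⟨
    sum (map large (e ∷ P)) + hubSmall q r
      ≤⟨ ℕ.+-monoˡ-≤ (hubSmall q r) (sum-unique≤sum-allFin large (unique-positions r i)) ⟩
    largeTotal + hubSmall q r
      ≡⟨ ℕ.+-comm largeTotal (hubSmall q r) ⟩
    hubSmall q r + largeTotal
      ≡⟨ hub-weight q r ⟨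
    generalWeight q r fzero + defect r fzero
      ≡⟨ cong (_+ defect r fzero) eq ⟩
    generalWeight q r (fsuc i) + defect r fzero
      ≤⟨ ℕ.+-mono-≤ (ℕ.m≤m+n _ (defect r i)) (defect≤1 r fzero) ⟩
    generalWeight q r (fsuc i) + defect r i + 1
      ≡⟨ cong (_+ 1) (rim-weight q r i) ⟩
    S + (20 + (rimVertical r + rimVertical q)) + 1
      ≤⟨ ℕ.+-monoˡ-≤ 1 (ℕ.+-monoʳ-≤ S (ℕ.+-monoʳ-≤ 20 (ℕ.+-mono-≤ (rimVertical≤3 r) (rimVertical≤3 q)))) ⟩
    S + 26 + 1
      ≡⟨ ℕ.+-assoc S 26 1 ⟩
    S + 27 ∎)
    where
    open ℕ.≤-Reasoning
    P = rimPositions r i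
    S = sum (map toℕ P)
    e = shift (extraOffset r) (prev (prev i))
    regroup : ∀ S → S + 31 ≡ 25 + S + 6
    regroup = solve-∀
    sum-large : ∀ a b c d f → 5 + a + (5 + b + (5 + c + (5 + d + (5 + f + 0)))) ≡ 25 + (a + (b + (c + (d + (f + 0)))))
    sum-large = solve-∀

  vertex-rim : ∀ r i → large (shift (vertexShift r) i) ≢ large (shift (vertexShift r) (next i))
  vertex-rim r i e = next≢id (shift (vertexShift r) i) (sym (trans (large-injective e) (shift-next (vertexShift r) i)))

  vertex-cycle : ∀ {q r s} → Window q r s → ∀ a → vertexColour q r a ≢ vertexColour r s a
  vertex-cycle w fzero = WindowFacts.hubColours≢ (facts w)
  vertex-cycle {r = r} {s} w (fsuc i) =
    WindowFacts.shifts≢ (facts w) ∘ shift-injectiveˡ _ _ i (shift<m r) (shift<m s) ∘ large-injective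
    where
    shift<m : ∀ r → vertexShift r < m
    shift<m even = s≤s (s≤s (s≤s z≤n))
    shift<m odd  = s≤s (s≤s (s≤s (s≤s z≤n)))
    shift<m last = s≤s (s≤s z≤n)

  spoke-range : ∀ r i → InRange (m + 4) (spokeColour r i)
  spoke-range even i        = large-range i
  spoke-range odd  i        = large-range i
  spoke-range last fzero    = small-range (s≤s z≤n , ℕ.≤-refl)
  spoke-range last (fsuc i) = large-range (fsuc i)

  general-valid : PatternValid generalPattern (m + 4)
  general-valid {q} {r} {s} w = windowValid
    (λ { fzero → small-range (hubColour-range q r) ; (fsuc i) → large-range _ })
    (λ { fzero → tiny-range (hubVertical-range r) ∷ tiny-range (hubVertical-range q)
                   ∷ All.map⁺ (All.tabulate λ {i} _ → spoke-range r i)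
       ; (fsuc i) → tiny-range (rimVertical-range r) ∷ tiny-range (rimVertical-range q) ∷ spoke-range r i
                   ∷ large-range (prev i) ∷ large-range (prev (prev i)) ∷ [] })
    (λ { fzero → hub-distinct q r hubColour≢up hubColour≢down hubVerticals≢
       ; (fsuc i) → rim-distinct q r i rimVerticals≢ })
    (λ i → small≢large _ (hubColour≤4 q r))
    (vertex-rim r)
    (vertex-cycle w)
    (hub-weight-spoke w)
    (rim-weight-rim q r)
    (λ { fzero → hub-weight-cycle w ; (fsuc i) → rim-weight-cycle w i })
    where open WindowFacts (facts w)

-- The construction in General needs m ≥ 6; smaller wheels are coloured by tables.

tables₃ : Tables 3
tables₃ = record
  { vertexTable = λ where
      even odd  → 3 ∷ 1 ∷ 5 ∷ 2 ∷ []
      even last → 3 ∷ 4 ∷ 2 ∷ 7 ∷ []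
      odd  even → 1 ∷ 2 ∷ 3 ∷ 4 ∷ []
      odd  last → 4 ∷ 2 ∷ 3 ∷ 6 ∷ []
      last even → 2 ∷ 3 ∷ 4 ∷ 5 ∷ []
      _    _    → Vec.replicate 4 0
  ; spokeTable = λ where
      even odd  → 5 ∷ 2 ∷ 4 ∷ []
      even last → 2 ∷ 5 ∷ 4 ∷ []
      odd  even → 3 ∷ 4 ∷ 5 ∷ []
      odd  last → 3 ∷ 6 ∷ 5 ∷ []
      last even → 4 ∷ 5 ∷ 7 ∷ []
      _    _    → Vec.replicate 3 0
  ; rimTable = λ where
      even odd  → 4 ∷ 1 ∷ 3 ∷ []
      even last → 7 ∷ 3 ∷ 5 ∷ []
      odd  even → 5 ∷ 2 ∷ 1 ∷ []
      odd  last → 5 ∷ 2 ∷ 4 ∷ []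
      last even → 7 ∷ 3 ∷ 2 ∷ []
      _    _    → Vec.replicate 3 0
  ; verticalTable = λ where
      even → 6
      odd  → 7
      last → 1
  }

tables₄ : Tables 4
tables₄ = record
  { vertexTable = λ where
      even odd  → 3 ∷ 2 ∷ 1 ∷ 2 ∷ 4 ∷ []
      even last → 3 ∷ 5 ∷ 6 ∷ 2 ∷ 4 ∷ []
      odd  even → 1 ∷ 3 ∷ 2 ∷ 3 ∷ 2 ∷ []
      odd  last → 4 ∷ 3 ∷ 2 ∷ 3 ∷ 2 ∷ []
      last even → 2 ∷ 4 ∷ 3 ∷ 4 ∷ 3 ∷ []
      _    _    → Vec.replicate 5 0
  ; spokeTable = λ where
      even odd  → 1 ∷ 2 ∷ 4 ∷ 6 ∷ []
      even last → 2 ∷ 4 ∷ 6 ∷ 8 ∷ []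
      odd  even → 2 ∷ 3 ∷ 4 ∷ 5 ∷ []
      odd  last → 2 ∷ 3 ∷ 5 ∷ 6 ∷ []
      last even → 3 ∷ 4 ∷ 5 ∷ 6 ∷ []
      _    _    → Vec.replicate 4 0
  ; rimTable = λ where
      even odd  → 3 ∷ 6 ∷ 3 ∷ 5 ∷ []
      even last → 3 ∷ 8 ∷ 3 ∷ 6 ∷ []
      odd  even → 1 ∷ 5 ∷ 1 ∷ 4 ∷ []
      odd  last → 4 ∷ 6 ∷ 4 ∷ 5 ∷ []
      last even → 2 ∷ 6 ∷ 2 ∷ 5 ∷ []
      _    _    → Vec.replicate 4 0
  ; verticalTable = λ where
      even → 7
      odd  → 8
      last → 1
  }

tables₅ : Tables 5
tables₅ = record
  { vertexTable = λ where
      even odd  → 3 ∷ 2 ∷ 1 ∷ 2 ∷ 4 ∷ 1 ∷ []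
      even last → 3 ∷ 5 ∷ 6 ∷ 2 ∷ 6 ∷ 7 ∷ []
      odd  even → 1 ∷ 3 ∷ 2 ∷ 3 ∷ 2 ∷ 5 ∷ []
      odd  last → 4 ∷ 3 ∷ 2 ∷ 3 ∷ 2 ∷ 8 ∷ []
      last even → 2 ∷ 4 ∷ 3 ∷ 4 ∷ 3 ∷ 6 ∷ []
      _    _    → Vec.replicate 6 0
  ; spokeTable = λ where
      even odd  → 1 ∷ 2 ∷ 4 ∷ 5 ∷ 7 ∷ []
      even last → 2 ∷ 4 ∷ 5 ∷ 7 ∷ 9 ∷ []
      odd  even → 2 ∷ 3 ∷ 4 ∷ 5 ∷ 6 ∷ []
      odd  last → 2 ∷ 3 ∷ 5 ∷ 6 ∷ 7 ∷ []
      last even → 3 ∷ 4 ∷ 5 ∷ 6 ∷ 7 ∷ []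
      _    _    → Vec.replicate 5 0
  ; rimTable = λ where
      even odd  → 3 ∷ 6 ∷ 3 ∷ 2 ∷ 5 ∷ []
      even last → 3 ∷ 7 ∷ 4 ∷ 3 ∷ 6 ∷ []
      odd  even → 1 ∷ 5 ∷ 1 ∷ 3 ∷ 4 ∷ []
      odd  last → 4 ∷ 6 ∷ 4 ∷ 3 ∷ 5 ∷ []
      last even → 2 ∷ 6 ∷ 2 ∷ 4 ∷ 5 ∷ []
      _    _    → Vec.replicate 5 0
  ; verticalTable = λ where
      even → 8
      odd  → 9
      last → 1
  }

upper-bound : ∀ m₀ n₀ → HasNSDTC (wheel (3 + m₀) □ cycle (3 + n₀)) (3 + m₀ + 4)
upper-bound 0 n₀ = tables⇒HasNSDTC tables₃ (from-yes (allWindowsValid? (fromTables tables₃) 7))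
  where open WheelCycle 0 n₀
upper-bound 1 n₀ = tables⇒HasNSDTC tables₄ (from-yes (allWindowsValid? (fromTables tables₄) 8))
  where open WheelCycle 1 n₀
upper-bound 2 n₀ = tables⇒HasNSDTC tables₅ (from-yes (allWindowsValid? (fromTables tables₅) 9))
  where open WheelCycle 2 n₀
upper-bound (suc (suc (suc m₁))) n₀ = PatternValid⇒HasNSDTC generalPattern general-valid
  where
  open WheelCycle (3 + m₁) n₀
  open General m₁ n₀

theorem4p6 : (m n : ℕ) → 3 ≤ m → 3 ≤ n →
    χΣ≡ (wheel m □ cycle n) (maxDegree (wheel m □ cycle n) + 2)
theorem4p6 (suc (suc (suc m₀))) (suc (suc (suc n₀))) (s≤s (s≤s (s≤s _))) (s≤s (s≤s (s≤s _))) =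
  subst (HasNSDTC G) (sym Δ+2≡m+4) (upper-bound m₀ n₀) ,
  λ k k<Δ+2 h → ℕ.<-irrefl refl (ℕ.<-≤-trans (subst (k <_) Δ+2≡m+4 k<Δ+2) (lower-bound h))
  where
  open WheelCycle m₀ n₀
  Δ+2≡m+4 : maxDegree G + 2 ≡ m + 4
  Δ+2≡m+4 = trans (cong (_+ 2) maxDegree≡) (trans (cong (_+ 2) (ℕ.+-comm 2 m)) (ℕ.+-assoc m 2 2))
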